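{- Let $\Sigma=(\Gamma,\sigma)$ be a signed graph, $\omega$ an orientation compatible with $\sigma$, and $G$ a finite additive abelian group. Then: (1) $f:E\to G$ is a $G$-tension of $\Sigma$ if and only if $\sum_{i=1}^k\big(\omega(v_i,e_i)\prod_{j=1}^{i-1}\sigma(e_j)\big)f(e_i)=0$ for every positive closed walk $W=(v_1,e_1,\dots,v_k,e_k,v_1)$; (2) $f:E\to G$ is a $G$-potential difference of $\Sigma$ if and only if $f$ is a $G$-tension and $\sum_{i=1}^kf(e_i)\in 2G$ for every negative closed walk $(v_1,e_1,\dots,v_k,e_k,v_1)$.
   Context: A signed graph $\Sigma=(\Gamma,\sigma)$: finite graph $\Gamma=(V,E)$ (loops, multiple edges allowed), $\sigma:E\to\{ -1,1\}$. A cycle (loops included) is balanced if the product of its edge signs is $1$, unbalanced otherwise. Each edge $e$ with endpoints $u,v$ has half-edges $(u,e),(v,e)$ (a loop at $v$ has two at $v$); an orientation $\omega$ assigns $\pm1$ to each half-edge, compatible with $\sigma$ if $\sigma(e)=-\omega(u,e)\omega(v,e)$. A walk $W=(v_1,e_1,\dots,v_k,e_k,v_{k+1})$ has $e_i$ joining $v_i,v_{i+1}$; $\omega(v_i,e_i)$ is the orientation of the half-edge of $e_i$ at $v_i$ by which the walk leaves $v_i$; $W$ is closed if $v_{k+1}=v_1$, positive if $\prod_i\sigma(e_i)=1$ and negative otherwise. Circuits of $\Sigma$: edge sets of balanced cycles, of unbalanced tight handcuffs (two unbalanced cycles sharing exactly one vertex) and of unbalanced loose handcuffs (two vertex-disjoint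 unbalanced cycles joined by a path meeting them only at its endpoints, whose edges are circuit path edges). A circuit walk is a closed walk traversing a circuit using circuit path edges twice and other edges once. $f:E\to G$ is a $G$-tension if the displayed sum in (1) vanishes for every circuit walk; it is a $G$-potential difference if additionally $\sum_i f(e_i)\in 2G=\{x+x:x\in G\}$ for every closed walk $(v_1,e_1,\dots,e_k,v_1)$ around an unbalanced cycle. -}

module Defs where

open import Level using (Level; _⊔_)
open import Data.Nat using (ℕ; zero; suc; _+_; _*_)
open import Data.Fin using (Fin; _≟_)
open import Data.Bool using (Bool; true; false; not)
open import Data.Sign using (Sign; opposite) renaming (_*_ to _·_; + to pos; - to neg)
open import Data.Product using (Σ; ∃; _×_; _,_; proj₁)
open import Data.Sum using (_⊎_)
open import Data.List using (List; []; _∷_; map; [_]; length)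
open import Data.List.Membership.Propositional using (_∈_)
open import Data.List.Relation.Unary.Unique.Propositional using (Unique)
open import Relation.Binary.PropositionalEquality using (_≡_; _≢_)
open import Relation.Nullary using (yes; no)
open import Algebra.Bundles using (AbelianGroup)

-- Every edge e has two half-edges
-- (e , false) and (e , true); 'end e b' is the vertex at which the
-- half-edge (e , b) lies.  A loop is an edge with end e false ≡ end e true.
-- Loops and multiple edges are allowed.

record SignedGraph : Set where
  field
    n   : ℕ
    m   : ℕ
    end : Fin m → Bool → Fin n
    σ   : Fin m → Sign

open SignedGraph public

Orientation : SignedGraph → Set
Orientation Σg = Fin (m Σg) → Bool → Sign

Compatible : (Σg : SignedGraph) → Orientation Σg → Set
Compatible Σg ω = ∀ e → σ Σg e ≡ opposite (ω e false · ω e true)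

FiniteGroup : ∀ {c ℓ} → AbelianGroup c ℓ → Set (c ⊔ ℓ)
FiniteGroup G = Σ ℕ λ k → Σ (Fin k → Carrier) λ enum → ∀ x → ∃ λ i → enum i ≈ x
  where open AbelianGroup G

module _ (Σg : SignedGraph) where

  V E : Set
  V = Fin (n Σg)
  E = Fin (m Σg)

  -- A step (e , b) of a walk traverses edge e leaving by the half-edge
  -- (e , b), i.e. from vertex end e b to vertex end e (not b).
  Step : Set
  Step = E × Bool

  tail head : Step → V
  tail (e , b) = end Σg e b
  head (e , b) = end Σg e (not b)

  IsWalk : V → List Step → V → Set
  IsWalk v [] w = v ≡ w
  IsWalk v (s ∷ W) w = tail s ≡ v × IsWalk (head s) W w

  edges : List Step → List E
  edges = map proj₁

  walkSign : List Step → Sign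
  walkSign [] = pos
  walkSign ((e , _) ∷ W) = σ Σg e · walkSign W

  occ : E → List Step → ℕ
  occ e [] = 0
  occ e ((e′ , _) ∷ W) with e ≟ e′
  ... | yes _ = suc (occ e W)
  ... | no  _ = occ e W

  IsCycleWalk : V → List Step → Set
  IsCycleWalk v W = IsWalk v W v × length W ≢ 0
                    × Unique (map tail W) × Unique (edges W)

  IsPath : V → List Step → V → Set
  IsPath u W w = IsWalk u W w × Unique (u ∷ map head W) × Unique (edges W)

  pathVerts : V → List Step → List V
  pathVerts u W = u ∷ map head W

  Balanced Unbalanced : List Step → Set
  Balanced W = walkSign W ≡ pos
  Unbalanced W = walkSign W ≡ neg

  -- Circuit walks: closed walks whose edge multiplicities are exactly those
  -- of a circuit (circuit path edges twice, other circuit edges once).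

  BalancedCycleCW : List Step → Set
  BalancedCycleCW W = Σ V λ v → Σ (List Step) λ C →
      IsCycleWalk v C × Balanced C × (∀ e → occ e W ≡ occ e C)

  TightHandcuffCW : List Step → Set
  TightHandcuffCW W = Σ V λ v₁ → Σ (List Step) λ C₁ → Σ V λ v₂ → Σ (List Step) λ C₂ →
      IsCycleWalk v₁ C₁ × Unbalanced C₁ × IsCycleWalk v₂ C₂ × Unbalanced C₂
      × (Σ V λ x → ∀ y → ((y ∈ map tail C₁ × y ∈ map tail C₂) → y ≡ x)
                       × (y ≡ x → (y ∈ map tail C₁ × y ∈ map tail C₂)))
      × (∀ e → occ e C₁ ≡ 0 ⊎ occ e C₂ ≡ 0)
      × (∀ e → occ e W ≡ occ e C₁ + occ e C₂)

  LooseHandcuffCW : List Step → Set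
  LooseHandcuffCW W = Σ V λ v₁ → Σ (List Step) λ C₁ → Σ V λ v₂ → Σ (List Step) λ C₂ →
      Σ V λ u → Σ (List Step) λ P → Σ V λ w →
      IsCycleWalk v₁ C₁ × Unbalanced C₁ × IsCycleWalk v₂ C₂ × Unbalanced C₂
      × (∀ y → y ∈ map tail C₁ → y ∈ map tail C₂ → Data.Empty.⊥)
      × IsPath u P w × u ∈ map tail C₁ × w ∈ map tail C₂
      × (∀ y → y ∈ pathVerts u P → (y ∈ map tail C₁ → y ≡ u) × (y ∈ map tail C₂ → y ≡ w))
      × (∀ e → occ e W ≡ occ e C₁ + occ e C₂ + 2 * occ e P)
    where import Data.Empty

  IsCircuitWalk : V → List Step → Set
  IsCircuitWalk v W = IsWalk v W v
    × (BalancedCycleCW W ⊎ TightHandcuffCW W ⊎ LooseHandcuffCW W)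

  module _ (ω : Orientation Σg) {c ℓ : Level} (G : AbelianGroup c ℓ) where
    open AbelianGroup G

    act : Sign → Carrier → Carrier
    act pos g = g
    act neg g = g ⁻¹

    -- Σ_i ( ω(v_i,e_i) ∏_{j<i} σ(e_j) ) f(e_i), with s the running prefix sign
    wsumFrom : (E → Carrier) → Sign → List Step → Carrier
    wsumFrom f s [] = ε
    wsumFrom f s ((e , b) ∷ W) = act (ω e b · s) (f e) ∙ wsumFrom f (s · σ Σg e) W

    wsum : (E → Carrier) → List Step → Carrier
    wsum f W = wsumFrom f pos W

    plainSum : (E → Carrier) → List Step → Carrier
    plainSum f [] = ε
    plainSum f ((e , _) ∷ W) = f e ∙ plainSum f W

    In2G : Carrier → Set (c ⊔ ℓ)
    In2G y = ∃ λ x → (x ∙ x) ≈ y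

    IsTension : (E → Carrier) → Set ℓ
    IsTension f = ∀ v W → IsCircuitWalk v W → wsum f W ≈ ε

    IsPotentialDifference : (E → Carrier) → Set (c ⊔ ℓ)
    IsPotentialDifference f = IsTension f
      × (∀ v W → IsCycleWalk v W → Unbalanced W → In2G (plainSum f W))

-- Send a walk W to ⟦ W ⟧ = (wsum W , walkSign W) in G ⋊ {±1}, where -1 acts by inversion:
-- concatenation becomes multiplication and, as ω is compatible with σ, reversal becomes
-- inversion.  Circuit walks are balanced, which gives one direction of (1).  For the other, a
-- balanced closed walk is shown trivial by induction on its length: cut it at its first
-- repeated vertex into a closed walk through distinct vertices (a cycle or a backtrack) and
-- the rest.  Balanced pieces are circuits and drop out.  An unbalanced cycle is paired with the
-- unbalanced rest, which is cut again until two unbalanced cycles joined by walks remain.  If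
-- they meet, the walk splits at a common vertex into two shorter closed walks, balanced after
-- possibly reversing one arc (negative elements of G ⋊ {±1} are involutions); otherwise, up to
-- shorter balanced closed walks, it is a conjugate of a tight or loose handcuff.
-- For (2): the sign action is trivial modulo 2G, so plainSum ≡ wsum modulo 2G, and plainSum is
-- additive; the same cutting splits every closed walk into balanced closed walks and
-- unbalanced cycles.

module Submission where

open import Defs
open import Level using (Level; _⊔_; 0ℓ)
open import Function using (_∘_)
open import Function.Bundles using (_⇔_; mk⇔)
open import Data.Empty using (⊥; ⊥-elim)
open import Data.Unit using (⊤; tt)
open import Data.Product using (_×_; _,_; proj₁; proj₂; ∃)
open import Data.Sum using (_⊎_; inj₁; inj₂; [_,_]′)
open import Data.Bool using (true; false; not) renaming (_≟_ to _≟ᵇ_)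
open import Data.Bool.Properties using (not-involutive; ¬-not)
open import Data.Nat using (ℕ; _+_; _*_; _<_; s≤s; z≤n)
import Data.Nat.Properties as ℕ
open import Data.Nat.Induction using (<-rec)
open import Data.Nat.Tactic.RingSolver using (solve-∀)
open import Data.Fin using () renaming (_≟_ to _≟ᶠ_)
open import Data.Sign using (Sign; opposite) renaming (_*_ to _·_; + to pos; - to neg)
import Data.Sign.Properties as Sign
open import Data.List using (List; []; _∷_; _++_; [_]; length; map)
open import Data.List.Properties
  using (map-++; ++-assoc; length-++; ++-identityʳ; length-++-comm; ++-conicalˡ; ++-conicalʳ; ++-monoid)
open import Data.List.Membership.Propositional using (_∈_; _∉_)
open import Data.List.Membership.Propositional.Properties
  using (∈-map⁺; ∈-map⁻; ∈-++⁺ˡ; ∈-++⁺ʳ; ∈-++⁻; ∈-∃++)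
import Data.List.Membership.DecPropositional
open import Data.List.Relation.Unary.Any using (here; there)
import Data.List.Relation.Unary.All as All
open import Data.List.Relation.Unary.All.Properties using (¬Any⇒All¬)
open import Data.List.Relation.Unary.AllPairs using ([]; _∷_)
open import Data.List.Relation.Unary.Unique.Propositional using (Unique)
open import Data.List.Relation.Unary.Unique.Propositional.Properties using (Unique[x∷xs]⇒x∉xs)
import Data.List.Relation.Unary.Unique.Propositional.Properties as Unique
open import Data.List.Relation.Binary.Permutation.Propositional using (_↭_; ↭-refl)
open import Data.List.Relation.Binary.Permutation.Propositional.Properties
  using (↭-length; ++-commutativeMonoid)
open import Algebra.Bundles using (AbelianGroup; Group; Monoid)
import Algebra.Properties.CommutativeSemigroup
import Algebra.Properties.Group
import Algebra.Solver.CommutativeMonoid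
open import Tactic.MonoidSolver using (solve)
open import Relation.Binary.Definitions using (DecidableEquality)
open import Relation.Binary.PropositionalEquality as ≡
  using (_≡_; _≢_; refl; cong; cong₂; subst)
import Relation.Binary.Reasoning.Setoid
open import Relation.Nullary using (¬_; yes; no)
open import Relation.Nullary.Decidable using (_×-dec_; ¬?; decidable-stable)
open import Relation.Unary using (Decidable)

module _ {a} {A : Set a} where

  Unique-∷ : ∀ {x : A} {xs} → x ∉ xs → Unique xs → Unique (x ∷ xs)
  Unique-∷ x∉xs u = ¬Any⇒All¬ _ x∉xs ∷ u

  Unique-++⁻ʳ : ∀ (xs : List A) {ys} → Unique (xs ++ ys) → Unique ys
  Unique-++⁻ʳ []       u       = u
  Unique-++⁻ʳ (x ∷ xs) (_ ∷ u) = Unique-++⁻ʳ xs u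

  Unique-++⇒∉ : ∀ (xs : List A) {ys z} → Unique (xs ++ ys) → z ∈ xs → z ∉ ys
  Unique-++⇒∉ (x ∷ xs) u (here refl) z∈ys = Unique[x∷xs]⇒x∉xs u (∈-++⁺ʳ xs z∈ys)
  Unique-++⇒∉ (x ∷ xs) (_ ∷ u) (there z∈xs) = Unique-++⇒∉ xs u z∈xs

  Unique-++⁻ˡ : ∀ (xs : List A) {ys} → Unique (xs ++ ys) → Unique xs
  Unique-++⁻ˡ []       u       = []
  Unique-++⁻ˡ (x ∷ xs) u@(_ ∷ u′) =
    Unique-∷ (λ x∈xs → Unique[x∷xs]⇒x∉xs u (∈-++⁺ˡ x∈xs)) (Unique-++⁻ˡ xs u′)

  Unique-++-comm : ∀ (xs : List A) {ys} → Unique (xs ++ ys) → Unique (ys ++ xs)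
  Unique-++-comm xs u = Unique.++⁺ (Unique-++⁻ʳ xs u) (Unique-++⁻ˡ xs u)
    (λ (z∈ys , z∈xs) → Unique-++⇒∉ xs u z∈xs z∈ys)

  length-<-++ʳ : ∀ (xs : List A) {ys} → ys ≢ [] → length xs < length (xs ++ ys)
  length-<-++ʳ xs {[]}    ys≢[] = ⊥-elim (ys≢[] refl)
  length-<-++ʳ xs {_ ∷ _} _     = subst (length xs <_) (≡.sym (length-++ xs)) (ℕ.m<m+n (length xs) (s≤s z≤n))

  ++≢[]ˡ : ∀ {xs : List A} ys → xs ≢ [] → xs ++ ys ≢ []
  ++≢[]ˡ {xs} ys xs≢[] eq = xs≢[] (++-conicalˡ xs ys eq)

  ++≢[]ʳ : ∀ xs {ys : List A} → ys ≢ [] → xs ++ ys ≢ []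
  ++≢[]ʳ xs {ys} ys≢[] eq = ys≢[] (++-conicalʳ xs ys eq)

  length-++-middle : ∀ (xs : List A) {ys ys′} zs → length ys ≡ length ys′ →
                     length (xs ++ ys ++ zs) ≡ length (xs ++ ys′ ++ zs)
  length-++-middle xs {ys} {ys′} zs eq = begin
    length (xs ++ ys ++ zs)               ≡⟨ length-++ xs ⟩
    length xs + length (ys ++ zs)         ≡⟨ cong (length xs +_) (length-++ ys) ⟩
    length xs + (length ys + length zs)   ≡⟨ cong (λ n → length xs + (n + length zs)) eq ⟩
    length xs + (length ys′ + length zs)  ≡⟨ cong (length xs +_) (length-++ ys′) ⟨
    length xs + length (ys′ ++ zs)        ≡⟨ length-++ xs ⟨
    length (xs ++ ys′ ++ zs)              ∎
    where open ≡.≡-Reasoning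

  length-<-↭ : ∀ {xs ys zs : List A} → ys ≢ [] → xs ++ ys ↭ zs → length xs < length zs
  length-<-↭ {xs} ys≢[] p = subst (length xs <_) (↭-length p) (length-<-++ʳ xs ys≢[])

  length-<-++ˡ : ∀ {xs : List A} ys → xs ≢ [] → length ys < length (xs ++ ys)
  length-<-++ˡ {xs} ys xs≢[] = subst (length ys <_) (length-++-comm ys xs) (length-<-++ʳ ys xs≢[])

module _ {a} {A : Set a} (_≟_ : DecidableEquality A) where

  open Data.List.Membership.DecPropositional _≟_ using (_∈?_)

  common? : ∀ {p} (P : A → Set p) → Decidable P → ∀ xs ys →
            (∃ λ v → v ∈ xs × v ∈ ys × P v) ⊎ (∀ {v} → v ∈ xs → v ∈ ys → ¬ P v)
  common? P P? []       ys = inj₂ λ ()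
  common? P P? (x ∷ xs) ys with common? P P? xs ys
  ... | inj₁ (v , v∈xs , v∈ys , pv) = inj₁ (v , there v∈xs , v∈ys , pv)
  ... | inj₂ none with x ∈? ys ×-dec P? x
  ...   | yes (x∈ys , px) = inj₁ (x , here refl , x∈ys , px)
  ...   | no  ¬both       = inj₂ λ { (here refl) x∈ys px → ¬both (x∈ys , px) ; (there v∈xs) → none v∈xs }

module _ {a b} {A : Set a} {B : Set b} (_≟_ : DecidableEquality B) (key : A → B) where

  open Data.List.Membership.DecPropositional _≟_ using (_∈?_)

  data FirstOccurrence (k : B) (xs : List A) : Set (a ⊔ b) where
    at : ∀ ys z zs → xs ≡ ys ++ z ∷ zs → key z ≡ k → k ∉ map key ys → FirstOccurrence k xs

  firstOccurrence : ∀ {k} xs → k ∈ map key xs → FirstOccurrence k xs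
  firstOccurrence {k} (x ∷ xs) k∈ with key x ≟ k
  ... | yes eq = at [] x xs refl eq λ ()
  ... | no neq with k∈
  ...   | here k≡ = ⊥-elim (neq (≡.sym k≡))
  ...   | there k∈xs with firstOccurrence xs k∈xs
  ...     | at ys z zs refl eq k∉ =
    at (x ∷ ys) z zs refl eq λ { (here k≡) → neq (≡.sym k≡) ; (there k∈ys) → k∉ k∈ys }

  data FirstRepeat : List A → Set (a ⊔ b) where
    distinct : ∀ {xs} → Unique (map key xs) → FirstRepeat xs
    repeat   : ∀ ys r rs z zs → key r ≡ key z → Unique (map key (ys ++ r ∷ rs)) →
               FirstRepeat (ys ++ r ∷ rs ++ z ∷ zs)

  private
    Unique-prefix : ∀ ys z zs → Unique (map key (ys ++ z ∷ zs)) → Unique (map key ys)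
    Unique-prefix ys z zs u = Unique-++⁻ˡ (map key ys) (subst Unique (map-++ key ys (z ∷ zs)) u)

  firstRepeat : ∀ xs → FirstRepeat xs
  firstRepeat [] = distinct []
  firstRepeat (x ∷ xs) with firstRepeat xs
  firstRepeat (x ∷ xs) | distinct u with key x ∈? map key xs
  ... | no x∉ = distinct (Unique-∷ x∉ u)
  ... | yes x∈ with firstOccurrence xs x∈
  ...   | at ys z zs refl eq x∉ = repeat [] x ys z zs (≡.sym eq) (Unique-∷ x∉ (Unique-prefix ys z zs u))
  firstRepeat (x ∷ _) | repeat ys r rs z zs eq u with key x ∈? map key (ys ++ r ∷ rs)
  ... | no x∉ = repeat (x ∷ ys) r rs z zs eq (Unique-∷ x∉ u)
  ... | yes x∈ with firstOccurrence (ys ++ r ∷ rs) x∈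
  ...   | at ys′ z′ zs′ split eq′ x∉ =
    subst (λ l → FirstRepeat (x ∷ l)) (≡.sym (rearrange split))
      (repeat [] x ys′ z′ (zs′ ++ z ∷ zs) (≡.sym eq′)
        (Unique-∷ x∉ (Unique-prefix ys′ z′ zs′ (subst (λ l → Unique (map key l)) split u))))
    where
      rearrange : ys ++ r ∷ rs ≡ ys′ ++ z′ ∷ zs′ → ys ++ r ∷ rs ++ z ∷ zs ≡ ys′ ++ z′ ∷ zs′ ++ z ∷ zs
      rearrange e = ≡.trans (≡.sym (++-assoc ys (r ∷ rs) (z ∷ zs)))
        (≡.trans (cong (_++ z ∷ zs) e) (++-assoc ys′ (z′ ∷ zs′) (z ∷ zs)))

opposite[x·y]·opposite[x]≡y : ∀ x y → opposite (x · y) · opposite x ≡ y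
opposite[x·y]·opposite[x]≡y pos pos = refl
opposite[x·y]·opposite[x]≡y pos neg = refl
opposite[x·y]·opposite[x]≡y neg pos = refl
opposite[x·y]·opposite[x]≡y neg neg = refl

x·y≡-⇒y·z≡-⇒x·z≡+ : ∀ x y z → x · y ≡ neg → y · z ≡ neg → x · z ≡ pos
x·y≡-⇒y·z≡-⇒x·z≡+ pos neg pos refl refl = refl
x·y≡-⇒y·z≡-⇒x·z≡+ neg pos neg refl refl = refl
x·y≡-⇒y·z≡-⇒x·z≡+ pos pos _   ()   _
x·y≡-⇒y·z≡-⇒x·z≡+ neg neg _   ()   _
x·y≡-⇒y·z≡-⇒x·z≡+ pos neg neg _    ()
x·y≡-⇒y·z≡-⇒x·z≡+ neg pos pos _    ()

module +-CS = Algebra.Properties.CommutativeSemigroup ℕ.+-commutativeSemigroup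
module ·-CS = Algebra.Properties.CommutativeSemigroup Sign.*-commutativeSemigroup

module GroupFacts {a ℓ} (H : Group a ℓ) where

  open Group H renaming (refl to ≈-refl; sym to ≈-sym; trans to ≈-trans)
  open import Algebra.Properties.Group H
  open import Relation.Binary.Reasoning.Setoid setoid
  import Algebra.Solver.Monoid monoid as Solver
  open Solver using (_⊕_; _⊜_)

  ∙≈ε-comm : ∀ x y → x ∙ y ≈ ε → y ∙ x ≈ ε
  ∙≈ε-comm x y xy≈ε = ≈-trans (∙-congʳ (inverseʳ-unique x y xy≈ε)) (inverseˡ x)

  private
    conjugate-form : ∀ r₁ r₂ q p s p⁻ q₂ → p ∙ p⁻ ≈ ε → q ∙ (p ∙ q₂) ≈ ε →
                     r₁ ∙ (r₂ ∙ (q ∙ (p ∙ (s ∙ q₂)))) ≈ r₁ ∙ (r₂ ∙ (q ∙ (p ∙ (s ∙ p⁻)) ∙ q ⁻¹))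
    conjugate-form r₁ r₂ q p s p⁻ q₂ pp⁻≈ε qpq₂≈ε = begin
      r₁ ∙ (r₂ ∙ (q ∙ (p ∙ (s ∙ q₂))))            ≈⟨ ∙-congˡ (∙-congˡ (∙-congˡ (∙-congˡ (∙-congˡ q₂≈))))
                                                   ⟩
      r₁ ∙ (r₂ ∙ (q ∙ (p ∙ (s ∙ (p⁻ ∙ q ⁻¹)))))    ≈⟨ Solver.solve 7 (λ r₁ r₂ q p s p⁻ q⁻ →
                                                       r₁ ⊕ (r₂ ⊕ (q ⊕ (p ⊕ (s ⊕ (p⁻ ⊕ q⁻))))) ⊜
                                                       r₁ ⊕ (r₂ ⊕ ((q ⊕ (p ⊕ (s ⊕ p⁻))) ⊕ q⁻)))
                                                     ≈-refl r₁ r₂ q p s p⁻ (q ⁻¹) ⟩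
      r₁ ∙ (r₂ ∙ (q ∙ (p ∙ (s ∙ p⁻)) ∙ q ⁻¹))      ∎
      where
        q₂≈ : q₂ ≈ p⁻ ∙ q ⁻¹
        q₂≈ = ≈-trans (y≈x\\z p q₂ (q ⁻¹) (inverseʳ-unique q (p ∙ q₂) qpq₂≈ε))
                    (∙-congʳ (≈-sym (inverseʳ-unique p p⁻ pp⁻≈ε)))

  looseHandcuff-≈ε : ∀ r₁ r₂ q p s p⁻ q₂ → p ∙ p⁻ ≈ ε → r₂ ∙ (r₁ ∙ (p ∙ (s ∙ p⁻))) ≈ ε →
                     q ∙ (p ∙ q₂) ≈ ε → q ≈ r₁ ⊎ q ∙ r₂ ≈ ε →
                     r₁ ∙ (r₂ ∙ (q ∙ (p ∙ (s ∙ q₂)))) ≈ ε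
  looseHandcuff-≈ε r₁ r₂ q p s p⁻ q₂ pp⁻≈ε handcuff closed (inj₁ q≈r₁) = begin
    r₁ ∙ (r₂ ∙ (q ∙ (p ∙ (s ∙ q₂))))   ≈⟨ conjugate-form r₁ r₂ q p s p⁻ q₂ pp⁻≈ε closed ⟩
    r₁ ∙ (r₂ ∙ (q ∙ d ∙ q ⁻¹))         ≈⟨ ∙-congˡ (∙-congˡ (∙-cong (∙-congʳ q≈r₁) (⁻¹-cong q≈r₁))) ⟩
    r₁ ∙ (r₂ ∙ (r₁ ∙ d ∙ r₁ ⁻¹))       ≈⟨ Solver.solve 4 (λ r₁ r₂ d r₁⁻ →
                                             r₁ ⊕ (r₂ ⊕ ((r₁ ⊕ d) ⊕ r₁⁻)) ⊜ (r₁ ⊕ (r₂ ⊕ (r₁ ⊕ d))) ⊕ r₁⁻)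
                                           ≈-refl r₁ r₂ d (r₁ ⁻¹) ⟩
    r₁ ∙ (r₂ ∙ (r₁ ∙ d)) ∙ r₁ ⁻¹       ≈⟨ ∙-congʳ (∙-congˡ handcuff) ⟩
    r₁ ∙ ε ∙ r₁ ⁻¹                     ≈⟨ ∙-congʳ (identityʳ r₁) ⟩
    r₁ ∙ r₁ ⁻¹                         ≈⟨ inverseʳ r₁ ⟩
    ε                                  ∎
    where
      d : Carrier
      d = p ∙ (s ∙ p⁻)
  looseHandcuff-≈ε r₁ r₂ q p s p⁻ q₂ pp⁻≈ε handcuff closed (inj₂ qr₂≈ε) = begin
    r₁ ∙ (r₂ ∙ (q ∙ (p ∙ (s ∙ q₂))))   ≈⟨ conjugate-form r₁ r₂ q p s p⁻ q₂ pp⁻≈ε closed ⟩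
    r₁ ∙ (r₂ ∙ (q ∙ d ∙ q ⁻¹))         ≈⟨ Solver.solve 5 (λ r₁ r₂ q d q⁻ →
                                             r₁ ⊕ (r₂ ⊕ ((q ⊕ d) ⊕ q⁻)) ⊜ r₁ ⊕ ((r₂ ⊕ q) ⊕ (d ⊕ q⁻)))
                                           ≈-refl r₁ r₂ q d (q ⁻¹) ⟩
    r₁ ∙ (r₂ ∙ q ∙ (d ∙ q ⁻¹))         ≈⟨ ∙-congˡ (elimˡ (∙≈ε-comm q r₂ qr₂≈ε) (d ∙ q ⁻¹)) ⟩
    r₁ ∙ (d ∙ q ⁻¹)                    ≈⟨ ∙-congˡ (∙-congˡ q⁻¹≈r₂) ⟩
    r₁ ∙ (d ∙ r₂)                      ≈⟨ ≈-sym (assoc r₁ d r₂) ⟩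
    r₁ ∙ d ∙ r₂                        ≈⟨ ∙≈ε-comm r₂ (r₁ ∙ d) handcuff ⟩
    ε                                  ∎
    where
      d : Carrier
      d = p ∙ (s ∙ p⁻)
      q⁻¹≈r₂ : q ⁻¹ ≈ r₂
      q⁻¹≈r₂ = ≈-trans (⁻¹-cong (inverseˡ-unique q r₂ qr₂≈ε)) (⁻¹-involutive r₂)
      open import Algebra.Properties.Monoid monoid using (elimˡ)

module SignSemidirect {c ℓ} (G : AbelianGroup c ℓ) where

  open AbelianGroup G renaming (refl to ≈-refl; sym to ≈-sym; trans to ≈-trans)
  open import Algebra.Properties.AbelianGroup G using (⁻¹-∙-comm; ε⁻¹≈ε; ⁻¹-involutive)
  open import Relation.Binary.Reasoning.Setoid setoid

  infixr 9 _⊙_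

  _⊙_ : Sign → Carrier → Carrier
  pos ⊙ g = g
  neg ⊙ g = g ⁻¹

  ⊙-cong : ∀ s {g h} → g ≈ h → s ⊙ g ≈ s ⊙ h
  ⊙-cong pos g≈h = g≈h
  ⊙-cong neg g≈h = ⁻¹-cong g≈h

  ⊙-homo-∙ : ∀ s g h → s ⊙ (g ∙ h) ≈ s ⊙ g ∙ s ⊙ h
  ⊙-homo-∙ pos g h = ≈-refl
  ⊙-homo-∙ neg g h = ≈-sym (⁻¹-∙-comm g h)

  ⊙-ε : ∀ s → s ⊙ ε ≈ ε
  ⊙-ε pos = ≈-refl
  ⊙-ε neg = ε⁻¹≈ε

  ⊙-· : ∀ s t g → (s · t) ⊙ g ≈ s ⊙ t ⊙ g
  ⊙-· pos t   g = ≈-refl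
  ⊙-· neg pos g = ≈-refl
  ⊙-· neg neg g = ≈-sym (⁻¹-involutive g)

  ⊙-involutive : ∀ s g → s ⊙ s ⊙ g ≈ g
  ⊙-involutive s g = ≈-trans (≈-sym (⊙-· s s g)) (reflexive (cong (_⊙ g) (Sign.s*s≡+ s)))

  ⊙-twisted-assoc : ∀ g h k s t → g ∙ s ⊙ h ∙ (s · t) ⊙ k ≈ g ∙ s ⊙ (h ∙ t ⊙ k)
  ⊙-twisted-assoc g h k s t = begin
    g ∙ s ⊙ h ∙ (s · t) ⊙ k     ≈⟨ ∙-congˡ (⊙-· s t k) ⟩
    g ∙ s ⊙ h ∙ s ⊙ t ⊙ k       ≈⟨ assoc g _ _ ⟩
    g ∙ (s ⊙ h ∙ s ⊙ t ⊙ k)     ≈⟨ ∙-congˡ (≈-sym (⊙-homo-∙ s h (t ⊙ k))) ⟩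
    g ∙ s ⊙ (h ∙ t ⊙ k)         ∎

  ⊙-inverseˡ : ∀ s g → s ⊙ (g ⁻¹) ∙ s ⊙ g ≈ ε
  ⊙-inverseˡ s g = begin
    s ⊙ (g ⁻¹) ∙ s ⊙ g   ≈⟨ ≈-sym (⊙-homo-∙ s (g ⁻¹) g) ⟩
    s ⊙ (g ⁻¹ ∙ g)       ≈⟨ ⊙-cong s (inverseˡ g) ⟩
    s ⊙ ε                ≈⟨ ⊙-ε s ⟩
    ε                    ∎

  Element : Set c
  Element = Carrier × Sign

  infix  4 _≋_
  infixl 7 _⊗_

  _≋_ : Element → Element → Set ℓ
  (g , s) ≋ (h , t) = g ≈ h × s ≡ t

  _⊗_ : Element → Element → Element
  (g , s) ⊗ (h , t) = g ∙ s ⊙ h , s · t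

  ⋊-group : Group c ℓ
  ⋊-group = record
    { Carrier = Element
    ; _≈_     = _≋_
    ; _∙_     = _⊗_
    ; ε       = ε , pos
    ; _⁻¹     = λ (g , s) → s ⊙ (g ⁻¹) , s
    ; isGroup = record
      { isMonoid = record
        { isSemigroup = record
          { isMagma = record
            { isEquivalence = record
              { refl  = ≈-refl , refl
              ; sym   = λ (p , q) → ≈-sym p , ≡.sym q
              ; trans = λ (p , q) (p′ , q′) → ≈-trans p p′ , ≡.trans q q′
              }
            ; ∙-cong = λ { {_ , s} (p , refl) (p′ , refl) → ∙-cong p (⊙-cong s p′) , refl }
            }
          ; assoc = λ (g , s) (h , t) (k , _) → ⊙-twisted-assoc g h k s t , Sign.*-assoc s t _
          }
        ; identity = (λ (g , s) → identityˡ g , refl)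
                   , (λ (g , s) → ≈-trans (∙-congˡ (⊙-ε s)) (identityʳ g) , Sign.*-identityʳ s)
        }
      ; inverse = (λ (g , s) → ⊙-inverseˡ s g , Sign.s*s≡+ s)
                , (λ (g , s) → ≈-trans (∙-congˡ (⊙-involutive s (g ⁻¹))) (inverseʳ g) , Sign.s*s≡+ s)
      ; ⁻¹-cong = λ { {_ , s} (p , refl) → ⊙-cong s (⁻¹-cong p) , refl }
      }
    }

  open Group ⋊-group public using () renaming (ε to 1⋊; _⁻¹ to _⁻¹⋊)

-- Walks

module Walks (Σg : SignedGraph) where

  tails heads : List (Step Σg) → List (V Σg)
  tails = map (tail Σg)
  heads = map (head Σg)

  IsWalk-++ : ∀ {x y z} A {B} → IsWalk Σg x A y → IsWalk Σg y B z → IsWalk Σg x (A ++ B) z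
  IsWalk-++ []      refl      wB = wB
  IsWalk-++ (_ ∷ A) (p , wA)  wB = p , IsWalk-++ A wA wB

  IsWalk-++⁻ : ∀ {x z} A {B} → IsWalk Σg x (A ++ B) z →
               ∃ λ y → IsWalk Σg x A y × IsWalk Σg y B z
  IsWalk-++⁻ []      w       = _ , refl , w
  IsWalk-++⁻ (_ ∷ A) (p , w) = let y , wA , wB = IsWalk-++⁻ A w in y , (p , wA) , wB

  tails-heads : ∀ {x y} W → IsWalk Σg x W y → x ∷ heads W ≡ tails W ++ [ y ]
  tails-heads []      refl    = refl
  tails-heads (_ ∷ W) (p , w) = cong₂ _∷_ (≡.sym p) (tails-heads W w)

  ∈-heads-last : ∀ {x y} s W → IsWalk Σg x (s ∷ W) y → y ∈ heads (s ∷ W)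
  ∈-heads-last s []       (_ , refl) = here refl
  ∈-heads-last s (t ∷ W)  (_ , w)    = there (∈-heads-last t W w)

  ∈-vertices : ∀ {x y t} W → IsWalk Σg x W y → t ∈ W →
               tail Σg t ∈ x ∷ heads W × head Σg t ∈ heads W
  ∈-vertices (_ ∷ W) (p , w) (here refl) = here p , here refl
  ∈-vertices (_ ∷ W) (p , w) (there t∈W) =
    let tail∈ , head∈ = ∈-vertices W w t∈W in there tail∈ , there head∈

  flipStep : Step Σg → Step Σg
  flipStep (e , b) = e , not b

  reverseWalk : List (Step Σg) → List (Step Σg)
  reverseWalk []      = []
  reverseWalk (s ∷ W) = reverseWalk W ++ [ flipStep s ]

  IsWalk-reverse : ∀ {x y} W → IsWalk Σg x W y → IsWalk Σg y (reverseWalk W) x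
  IsWalk-reverse []            refl    = refl
  IsWalk-reverse ((e , b) ∷ W) (p , w) =
    IsWalk-++ (reverseWalk W) (IsWalk-reverse W w) (refl , ≡.trans (cong (end Σg e) (not-involutive b)) p)

  length-reverseWalk : ∀ W → length (reverseWalk W) ≡ length W
  length-reverseWalk []      = refl
  length-reverseWalk (s ∷ W) =
    ≡.trans (length-++ (reverseWalk W)) (≡.trans (cong (_+ 1) (length-reverseWalk W)) (ℕ.+-comm _ 1))

  walkSign-++ : ∀ A B → walkSign Σg (A ++ B) ≡ walkSign Σg A · walkSign Σg B
  walkSign-++ []            B = refl
  walkSign-++ ((e , _) ∷ A) B =
    ≡.trans (cong (σ Σg e ·_) (walkSign-++ A B)) (≡.sym (Sign.*-assoc (σ Σg e) _ _))

  walkSign-comm : ∀ A B → walkSign Σg (A ++ B) ≡ walkSign Σg (B ++ A)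
  walkSign-comm A B = ≡.trans (walkSign-++ A B)
    (≡.trans (Sign.*-comm (walkSign Σg A) (walkSign Σg B)) (≡.sym (walkSign-++ B A)))

  reverseWalk≡[]⇒≡[] : ∀ W → reverseWalk W ≡ [] → W ≡ []
  reverseWalk≡[]⇒≡[] []      _  = refl
  reverseWalk≡[]⇒≡[] (s ∷ W) eq with ++-conicalʳ (reverseWalk W) [ flipStep s ] eq
  ... | ()

  walkSign-reverse : ∀ W → walkSign Σg (reverseWalk W) ≡ walkSign Σg W
  walkSign-reverse []            = refl
  walkSign-reverse ((e , b) ∷ W) = begin
    walkSign Σg (reverseWalk W ++ [ (e , not b) ])     ≡⟨ walkSign-comm (reverseWalk W) _ ⟩
    σ Σg e · walkSign Σg (reverseWalk W)                ≡⟨ cong (σ Σg e ·_) (walkSign-reverse W) ⟩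
    σ Σg e · walkSign Σg W                              ∎
    where open ≡.≡-Reasoning

  backtrack-balanced : ∀ s → Balanced Σg (s ∷ flipStep s ∷ [])
  backtrack-balanced (e , _) = ≡.trans (cong (σ Σg e ·_) (Sign.*-identityʳ (σ Σg e))) (Sign.s*s≡+ (σ Σg e))

  reverseWalk-++ : ∀ A B → reverseWalk (A ++ B) ≡ reverseWalk B ++ reverseWalk A
  reverseWalk-++ []      B = ≡.sym (++-identityʳ (reverseWalk B))
  reverseWalk-++ (s ∷ A) B = ≡.trans (cong (_++ [ flipStep s ]) (reverseWalk-++ A B))
                                     (++-assoc (reverseWalk B) (reverseWalk A) [ flipStep s ])

  path-edges-unique : ∀ {x y} W → IsWalk Σg x W y → Unique (x ∷ heads W) → Unique (edges Σg W)
  path-edges-unique []            _       _              = []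
  path-edges-unique ((e , b) ∷ W) (p , w) u@(_ ∷ u′) = Unique-∷ e∉ (path-edges-unique W w u′)
    where
      e∉ : e ∉ edges Σg W
      e∉ e∈ with ∈-map⁻ proj₁ e∈
      ... | (_ , d) , t∈W , refl with ∈-vertices W w t∈W | b ≟ᵇ d
      ... | tail∈ , _     | yes refl = Unique[x∷xs]⇒x∉xs u (subst (_∈ _) p tail∈)
      ... | _     , head∈ | no  b≢d with refl ← ¬-not (b≢d ∘ ≡.sym) = Unique[x∷xs]⇒x∉xs u
            (there (subst (_∈ _) (≡.trans (cong (end Σg e) (not-involutive b)) p) head∈))

  occ-∷ : ∀ e s W → occ Σg e (s ∷ W) ≡ occ Σg e [ s ] + occ Σg e W
  occ-∷ e (e′ , _) W with e ≟ᶠ e′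
  ... | yes _ = refl
  ... | no  _ = refl

  occ-++ : ∀ e A B → occ Σg e (A ++ B) ≡ occ Σg e A + occ Σg e B
  occ-++ e []      B = refl
  occ-++ e (s ∷ A) B = begin
    occ Σg e (s ∷ A ++ B)                             ≡⟨ occ-∷ e s (A ++ B) ⟩
    occ Σg e [ s ] + occ Σg e (A ++ B)                ≡⟨ cong (occ Σg e [ s ] +_) (occ-++ e A B) ⟩
    occ Σg e [ s ] + (occ Σg e A + occ Σg e B)        ≡⟨ ≡.sym (ℕ.+-assoc (occ Σg e [ s ]) _ _) ⟩
    occ Σg e [ s ] + occ Σg e A + occ Σg e B          ≡⟨ cong (_+ occ Σg e B) (≡.sym (occ-∷ e s A)) ⟩
    occ Σg e (s ∷ A) + occ Σg e B                     ∎
    where open ≡.≡-Reasoning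

  occ-[]-direction : ∀ e e′ b b′ → occ Σg e [ (e′ , b) ] ≡ occ Σg e [ (e′ , b′) ]
  occ-[]-direction e e′ _ _ with e ≟ᶠ e′
  ... | yes _ = refl
  ... | no  _ = refl

  occ-self : ∀ e b W → occ Σg e ((e , b) ∷ W) ≢ 0
  occ-self e b W with e ≟ᶠ e
  ... | yes _  = λ ()
  ... | no e≢e = ⊥-elim (e≢e refl)

  occ≢0⇒∈ : ∀ e W → occ Σg e W ≢ 0 → e ∈ edges Σg W
  occ≢0⇒∈ e []             occ≢0 = ⊥-elim (occ≢0 refl)
  occ≢0⇒∈ e ((e′ , _) ∷ W) occ≢0 with e ≟ᶠ e′
  ... | yes e≡e′ = here e≡e′
  ... | no  _    = there (occ≢0⇒∈ e W occ≢0)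

  walkSign-occ : ∀ W W′ → (∀ e → occ Σg e W ≡ occ Σg e W′) → walkSign Σg W ≡ walkSign Σg W′
  walkSign-occ [] []                  _    = refl
  walkSign-occ [] ((e′ , b′) ∷ W′)    same = ⊥-elim (occ-self e′ b′ W′ (≡.sym (same e′)))
  walkSign-occ ((e , b) ∷ W) W′ same
    with (e , b′) , s∈W′ , refl ←
           ∈-map⁻ proj₁ (occ≢0⇒∈ e W′ (λ occ≡0 → occ-self e b W (≡.trans (same e) occ≡0)))
    with X , Y , refl ← ∈-∃++ s∈W′ = begin
      σ Σg e · walkSign Σg W                         ≡⟨ cong (σ Σg e ·_) (walkSign-occ W (X ++ Y) same′) ⟩
      σ Σg e · walkSign Σg (X ++ Y)                  ≡⟨ cong (σ Σg e ·_) (walkSign-++ X Y) ⟩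
      σ Σg e · (walkSign Σg X · walkSign Σg Y)       ≡⟨ ·-CS.x∙yz≈y∙xz (σ Σg e) (walkSign Σg X) (walkSign Σg Y) ⟩
      walkSign Σg X · (σ Σg e · walkSign Σg Y)       ≡⟨ ≡.sym (walkSign-++ X ((e , b′) ∷ Y)) ⟩
      walkSign Σg (X ++ (e , b′) ∷ Y)                ∎
    where
      open ≡.≡-Reasoning
      same′ : ∀ e″ → occ Σg e″ W ≡ occ Σg e″ (X ++ Y)
      same′ e″ = ℕ.+-cancelˡ-≡ (occ Σg e″ [ (e , b) ]) _ _ (begin
        occ Σg e″ [ (e , b) ] + occ Σg e″ W                        ≡⟨ ≡.sym (occ-∷ e″ (e , b) W) ⟩
        occ Σg e″ ((e , b) ∷ W)                                    ≡⟨ same e″ ⟩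
        occ Σg e″ (X ++ (e , b′) ∷ Y)                              ≡⟨ occ-++ e″ X _ ⟩
        occ Σg e″ X + occ Σg e″ ((e , b′) ∷ Y)                     ≡⟨ cong (occ Σg e″ X +_) (occ-∷ e″ (e , b′) Y) ⟩
        occ Σg e″ X + (occ Σg e″ [ (e , b′) ] + occ Σg e″ Y)       ≡⟨ +-CS.x∙yz≈y∙xz (occ Σg e″ X)
                                                                     (occ Σg e″ [ (e , b′) ]) (occ Σg e″ Y) ⟩
        occ Σg e″ [ (e , b′) ] + (occ Σg e″ X + occ Σg e″ Y)       ≡⟨ cong₂ _+_ (occ-[]-direction e″ e b′ b)
                                                                                (≡.sym (occ-++ e″ X Y)) ⟩
        occ Σg e″ [ (e , b) ] + occ Σg e″ (X ++ Y)                 ∎)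

  ∈-tails-comm : ∀ {y} A B → y ∈ tails (A ++ B) → y ∈ tails (B ++ A)
  ∈-tails-comm A B y∈ with ∈-++⁻ (tails A) (subst (_ ∈_) (map-++ (tail Σg) A B) y∈)
  ... | inj₁ y∈A = subst (_ ∈_) (≡.sym (map-++ (tail Σg) B A)) (∈-++⁺ʳ (tails B) y∈A)
  ... | inj₂ y∈B = subst (_ ∈_) (≡.sym (map-++ (tail Σg) B A)) (∈-++⁺ˡ y∈B)

  IsCycleWalk-rotate : ∀ {u w} A B → IsCycleWalk Σg u (A ++ B) → IsWalk Σg u A w → IsWalk Σg w B u →
                       B ≢ [] → IsCycleWalk Σg w (B ++ A)
  IsCycleWalk-rotate A []      _                    _  _  B≢[] = ⊥-elim (B≢[] refl)
  IsCycleWalk-rotate A (b ∷ B) (_ , _ , u-ts , u-es) wA wB _   =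
    IsWalk-++ (b ∷ B) wB wA , (λ ()) ,
    rotate (tail Σg) u-ts , rotate proj₁ u-es
    where
      rotate : ∀ {X : Set} (g : Step Σg → X) → Unique (map g (A ++ b ∷ B)) → Unique (map g (b ∷ B ++ A))
      rotate g u = subst Unique (≡.sym (map-++ g (b ∷ B) A))
                     (Unique-++-comm (map g A) (subst Unique (map-++ g A (b ∷ B)) u))

  occ-reverseWalk : ∀ e W → occ Σg e (reverseWalk W) ≡ occ Σg e W
  occ-reverseWalk e []            = refl
  occ-reverseWalk e ((e′ , b) ∷ W) = begin
    occ Σg e (reverseWalk W ++ [ (e′ , not b) ])             ≡⟨ occ-++ e (reverseWalk W) _ ⟩
    occ Σg e (reverseWalk W) + occ Σg e [ (e′ , not b) ]    ≡⟨ cong₂ _+_ (occ-reverseWalk e W)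
                                                                          (occ-[]-direction e e′ (not b) b) ⟩
    occ Σg e W + occ Σg e [ (e′ , b) ]                       ≡⟨ ℕ.+-comm (occ Σg e W) _ ⟩
    occ Σg e [ (e′ , b) ] + occ Σg e W                       ≡⟨ occ-∷ e (e′ , b) W ⟨
    occ Σg e ((e′ , b) ∷ W)                                  ∎
    where open ≡.≡-Reasoning

  occ-handcuff : ∀ e C₁ P C₂ → occ Σg e (C₁ ++ P ++ C₂ ++ reverseWalk P) ≡
                               occ Σg e C₁ + occ Σg e C₂ + 2 * occ Σg e P
  occ-handcuff e C₁ P C₂ = begin
    occ Σg e (C₁ ++ P ++ C₂ ++ reverseWalk P)                 ≡⟨ occ-++ e C₁ _ ⟩
    occ Σg e C₁ + occ Σg e (P ++ C₂ ++ reverseWalk P)         ≡⟨ cong (occ Σg e C₁ +_) (occ-++ e P _) ⟩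
    occ Σg e C₁ + (occ Σg e P + occ Σg e (C₂ ++ reverseWalk P)) ≡⟨ cong (λ n → occ Σg e C₁ + (occ Σg e P + n))
                                                                    (≡.trans (occ-++ e C₂ _) (cong (occ Σg e C₂ +_) (occ-reverseWalk e P))) ⟩
    occ Σg e C₁ + (occ Σg e P + (occ Σg e C₂ + occ Σg e P))  ≡⟨ counts (occ Σg e C₁) (occ Σg e P) (occ Σg e C₂) ⟩
    occ Σg e C₁ + occ Σg e C₂ + 2 * occ Σg e P                ∎
    where
      open ≡.≡-Reasoning
      counts : ∀ a p c → a + (p + (c + p)) ≡ a + c + 2 * p
      counts = solve-∀

  walkSign-++-middle : ∀ A M C → walkSign Σg (A ++ M ++ C) ≡ walkSign Σg M · walkSign Σg (A ++ C)
  walkSign-++-middle A M C = begin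
    walkSign Σg (A ++ M ++ C)                            ≡⟨ walkSign-++ A (M ++ C) ⟩
    walkSign Σg A · walkSign Σg (M ++ C)                 ≡⟨ cong (walkSign Σg A ·_) (walkSign-++ M C) ⟩
    walkSign Σg A · (walkSign Σg M · walkSign Σg C)      ≡⟨ ·-CS.x∙yz≈y∙xz (walkSign Σg A)
                                                                         (walkSign Σg M) (walkSign Σg C) ⟩
    walkSign Σg M · (walkSign Σg A · walkSign Σg C)      ≡⟨ cong (walkSign Σg M ·_) (walkSign-++ A C) ⟨
    walkSign Σg M · walkSign Σg (A ++ C)                 ∎
    where open ≡.≡-Reasoning

  walkSign-drop-balanced : ∀ A M C → Balanced Σg M → walkSign Σg (A ++ M ++ C) ≡ walkSign Σg (A ++ C)
  walkSign-drop-balanced A M C M-bal = ≡.trans (walkSign-++-middle A M C) (cong (_· walkSign Σg (A ++ C)) M-bal)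

  walkSign-drop-unbalanced : ∀ A M C → Unbalanced Σg M → walkSign Σg (A ++ M ++ C) ≡ opposite (walkSign Σg (A ++ C))
  walkSign-drop-unbalanced A M C M-unb = ≡.trans (walkSign-++-middle A M C) (cong (_· walkSign Σg (A ++ C)) M-unb)

  handcuffWalk-balanced : ∀ R Q₁ S Q₂ → Unbalanced Σg R → Unbalanced Σg S → Balanced Σg (Q₁ ++ Q₂) →
                          Balanced Σg (R ++ Q₁ ++ S ++ Q₂)
  handcuffWalk-balanced R Q₁ S Q₂ R-unb S-unb Q-bal = begin
    walkSign Σg (R ++ Q₁ ++ S ++ Q₂)                     ≡⟨ walkSign-++ R _ ⟩
    walkSign Σg R · walkSign Σg (Q₁ ++ S ++ Q₂)          ≡⟨ cong (walkSign Σg R ·_) (walkSign-++-middle Q₁ S Q₂) ⟩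
    walkSign Σg R · (walkSign Σg S · walkSign Σg (Q₁ ++ Q₂))  ≡⟨ cong₂ (λ r s → r · (s · _)) R-unb S-unb ⟩
    neg · (neg · walkSign Σg (Q₁ ++ Q₂))                 ≡⟨ cong (λ q → neg · (neg · q)) Q-bal ⟩
    pos                                                  ∎
    where open ≡.≡-Reasoning

  walk-and-back-balanced : ∀ P → Balanced Σg (P ++ reverseWalk P)
  walk-and-back-balanced P = ≡.trans (walkSign-++ P (reverseWalk P))
    (≡.trans (cong (walkSign Σg P ·_) (walkSign-reverse P)) (Sign.s*s≡+ (walkSign Σg P)))

  circuitWalk-balanced : ∀ {v} W → IsCircuitWalk Σg v W → Balanced Σg W
  circuitWalk-balanced W (_ , inj₁ (_ , C , _ , C-bal , same)) =
    ≡.trans (walkSign-occ W C same) C-bal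
  circuitWalk-balanced W (_ , inj₂ (inj₁ (_ , C₁ , _ , C₂ , _ , C₁-unb , _ , C₂-unb , _ , _ , same))) =
    ≡.trans (walkSign-occ W (C₁ ++ C₂) (λ e → ≡.trans (same e) (≡.sym (occ-++ e C₁ C₂))))
            (subst (λ C → Balanced Σg (C₁ ++ C)) (++-identityʳ C₂)
                   (handcuffWalk-balanced C₁ [] C₂ [] C₁-unb C₂-unb refl))
  circuitWalk-balanced W (_ , inj₂ (inj₂ (_ , C₁ , _ , C₂ , _ , P , _ , _ , C₁-unb , _ , C₂-unb , _ , _ , _ , _ , _ , same))) =
    ≡.trans (walkSign-occ W (C₁ ++ P ++ C₂ ++ reverseWalk P)
                          (λ e → ≡.trans (same e) (≡.sym (occ-handcuff e C₁ P C₂))))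
            (handcuffWalk-balanced C₁ P C₂ (reverseWalk P) C₁-unb C₂-unb (walk-and-back-balanced P))

  length-++-reverseWalk : ∀ A B → length (A ++ reverseWalk B) ≡ length (A ++ B)
  length-++-reverseWalk A B =
    ≡.trans (length-++ A) (≡.trans (cong (length A +_) (length-reverseWalk B)) (≡.sym (length-++ A)))

  vertices-++ : ∀ {x y} A B → IsWalk Σg x A y → x ∷ heads (A ++ B) ≡ tails A ++ y ∷ heads B
  vertices-++ {x} {y} A B wA = begin
    x ∷ heads (A ++ B)              ≡⟨ cong (x ∷_) (map-++ (head Σg) A B) ⟩
    (x ∷ heads A) ++ heads B        ≡⟨ cong (_++ heads B) (tails-heads A wA) ⟩
    (tails A ++ [ y ]) ++ heads B   ≡⟨ ++-assoc (tails A) [ y ] (heads B) ⟩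
    tails A ++ y ∷ heads B          ∎
    where open ≡.≡-Reasoning

  vertices-unique : ∀ {x y} W S → IsWalk Σg x W y → Unique (tails (W ++ S)) → y ∈ tails S →
                    Unique (x ∷ heads W)
  vertices-unique W S w u y∈S = subst Unique (≡.sym (tails-heads W w))
    (Unique.++⁺ (Unique-++⁻ˡ (tails W) u′) (All.[] ∷ [])
      λ { (y∈W , here refl) → Unique-++⇒∉ (tails W) u′ y∈W y∈S })
    where
      u′ : Unique (tails W ++ tails S)
      u′ = subst Unique (map-++ (tail Σg) W S) u

-- Decomposing closed walks

module ClosedWalkDecomposition (Σg : SignedGraph) where

  open Walks Σg
  open Data.List.Membership.DecPropositional (_≟ᶠ_ {m Σg}) using () renaming (_∈?_ to _∈ᴱ?_)
  open Data.List.Membership.DecPropositional (_≟ᶠ_ {n Σg}) using () renaming (_∈?_ to _∈ⱽ?_)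

  closedWalk-heads-unique : ∀ {x} s W → IsWalk Σg x (s ∷ W) x → Unique (tails (s ∷ W)) →
                            Unique (head Σg s ∷ heads W)
  closedWalk-heads-unique s W (p , w) u = subst Unique (≡.sym (tails-heads W w))
    (subst (λ v → Unique (tails W ++ [ v ])) p (Unique-++-comm [ tail Σg s ] u))

  closedWalk-∈-tails : ∀ {x t} W → IsWalk Σg x W x → t ∈ W → tail Σg t ∈ tails W × head Σg t ∈ tails W
  closedWalk-∈-tails {t = t} W@(_ ∷ _) w@(p , _) t∈W = ∈-map⁺ (tail Σg) t∈W , head∈
    where
      head∈ : head Σg t ∈ tails W
      head∈ with ∈-++⁻ (tails W) (subst (head Σg t ∈_) (tails-heads W w) (there (proj₂ (∈-vertices W w t∈W))))
      ... | inj₁ ∈tails     = ∈tails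
      ... | inj₂ (here eq) = here (≡.trans eq (≡.sym p))

  closedWalk-ends-∈-tails : ∀ {x e d} W → IsWalk Σg x W x → (e , d) ∈ W → ∀ b → end Σg e b ∈ tails W
  closedWalk-ends-∈-tails {d = d} W w t∈W b with b ≟ᵇ d
  ... | yes refl = proj₁ (closedWalk-∈-tails W w t∈W)
  ... | no  b≢d with refl ← ¬-not (b≢d ∘ ≡.sym) =
    subst (λ b → end Σg _ b ∈ tails W) (not-involutive b) (proj₂ (closedWalk-∈-tails W w t∈W))

  unbalanced-≢[] : ∀ {W} → Unbalanced Σg W → W ≢ []
  unbalanced-≢[] W-unb refl with W-unb
  ... | ()

  cycleWalk-≢[] : ∀ {x W} → IsCycleWalk Σg x W → W ≢ []
  cycleWalk-≢[] (_ , length≢0 , _) refl = length≢0 refl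

  cycleWalk-start-∈-tails : ∀ {x W} → IsCycleWalk Σg x W → x ∈ tails W
  cycleWalk-start-∈-tails {W = []}    (_ , W≢[] , _) = ⊥-elim (W≢[] refl)
  cycleWalk-start-∈-tails {W = _ ∷ _} ((p , _) , _)  = here (≡.sym p)

  closedWalk-loop : ∀ {x t} W → IsWalk Σg x W x → Unique (tails W) → t ∈ W →
                    tail Σg t ≡ x → head Σg t ≡ x → W ≡ [ t ]
  closedWalk-loop (t ∷ [])     _            _ (here refl) _     _     = refl
  closedWalk-loop (t ∷ t′ ∷ W) (_ , p′ , _) u (here refl) tail≡ head≡ =
    ⊥-elim (Unique[x∷xs]⇒x∉xs u (here (≡.trans tail≡ (≡.sym (≡.trans p′ head≡)))))
  closedWalk-loop (t′ ∷ W)     (p , _)      u (there t∈W) tail≡ _ =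
    ⊥-elim (Unique[x∷xs]⇒x∉xs u (subst (_∈ tails W) (≡.trans tail≡ (≡.sym p)) (∈-map⁺ (tail Σg) t∈W)))

  sharedEdge-loop : ∀ {u e d d′} R S → IsCycleWalk Σg u R → IsCycleWalk Σg u S →
                    (∀ {v} → v ∈ tails R → v ∈ tails S → v ≡ u) →
                    (e , d) ∈ R → (e , d′) ∈ S → R ≡ [ (e , d) ] × S ≡ [ (e , d′) ]
  sharedEdge-loop {u} {e} {d} {d′} R S cR cS meet t∈R t′∈S =
    closedWalk-loop R (proj₁ cR) (proj₁ (proj₂ (proj₂ cR))) t∈R (at-u d) (at-u (not d)) ,
    closedWalk-loop S (proj₁ cS) (proj₁ (proj₂ (proj₂ cS))) t′∈S (at-u d′) (at-u (not d′))
    where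
      at-u : ∀ b → end Σg e b ≡ u
      at-u b = meet (closedWalk-ends-∈-tails R (proj₁ cR) t∈R b) (closedWalk-ends-∈-tails S (proj₁ cS) t′∈S b)

  path-through-flipStep : ∀ s R → IsWalk Σg (head Σg s) R (tail Σg s) → Unique (head Σg s ∷ heads R) →
                         flipStep s ∈ R → R ≡ [ flipStep s ]
  path-through-flipStep s       (t ∷ [])     _       _       (here refl) = refl
  path-through-flipStep (e , b) (t ∷ t′ ∷ R) (_ , w) (_ ∷ u) (here refl) = ⊥-elim (Unique[x∷xs]⇒x∉xs u
    (subst (_∈ heads (t′ ∷ R)) (cong (end Σg e) (≡.sym (not-involutive b))) (∈-heads-last t′ R w)))
  path-through-flipStep s       (t ∷ R)      (_ , w) u       (there t∈R) =
    ⊥-elim (Unique[x∷xs]⇒x∉xs u (proj₁ (∈-vertices R w t∈R)))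

  tails-suffix-unique : ∀ A B → Unique (tails (A ++ B)) → Unique (tails B)
  tails-suffix-unique A B u = Unique-++⁻ʳ (tails A) (subst Unique (map-++ (tail Σg) A B) u)

  data SimpleClosedWalk (x : V Σg) : List (Step Σg) → Set where
    cycle     : ∀ {W} → IsCycleWalk Σg x W → SimpleClosedWalk x W
    backtrack : ∀ s → SimpleClosedWalk x (s ∷ flipStep s ∷ [])

  simpleClosedWalk : ∀ {x} W → W ≢ [] → IsWalk Σg x W x → Unique (tails W) → SimpleClosedWalk x W
  simpleClosedWalk []            W≢[] _ _ = ⊥-elim (W≢[] refl)
  simpleClosedWalk (s@(e , b) ∷ W) _  w@(p , w′) u with e ∈ᴱ? edges Σg W
  ... | no e∉ = cycle (w , (λ ()) , u , Unique-∷ e∉ (path-edges-unique W w′ (closedWalk-heads-unique s W w u)))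
  ... | yes e∈ with ∈-map⁻ proj₁ e∈
  ... | (_ , d) , t∈W , refl with b ≟ᵇ d
  ...   | yes refl = ⊥-elim (Unique[x∷xs]⇒x∉xs (closedWalk-heads-unique s W w u) (proj₂ (∈-vertices W w′ t∈W)))
  ...   | no b≢d with refl ← ¬-not (b≢d ∘ ≡.sym)
                 with refl ← path-through-flipStep s W (subst (IsWalk Σg _ W) (≡.sym p) w′)
                                                   (closedWalk-heads-unique s W w u) t∈W = backtrack s

  simpleClosedWalk-unbalanced : ∀ {x W} → SimpleClosedWalk x W → Unbalanced Σg W → IsCycleWalk Σg x W
  simpleClosedWalk-unbalanced (cycle cw)    _   = cw
  simpleClosedWalk-unbalanced (backtrack s) unb with ≡.trans (≡.sym (backtrack-balanced s)) unb
  ... | ()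

  data ClosedWalkSplit (x : V Σg) : List (Step Σg) → Set where
    simple : ∀ {W} → Unique (tails W) → ClosedWalkSplit x W
    split  : ∀ {y} A R B → R ≢ [] → B ≢ [] →
             IsWalk Σg x A y → IsWalk Σg y R y → IsWalk Σg y B x →
             Unique (tails (A ++ R)) → ClosedWalkSplit x (A ++ R ++ B)

  closedWalkSplit : ∀ {x} W → IsWalk Σg x W x → ClosedWalkSplit x W
  closedWalkSplit W w with firstRepeat _≟ᶠ_ (tail Σg) W
  ... | distinct u = simple u
  ... | repeat A r R b B r~b u
    with y , wA , w′ ← IsWalk-++⁻ A w
    with _ , (p , wR) , (q , wB) ← IsWalk-++⁻ (r ∷ R) w′ =
    split A (r ∷ R) (b ∷ B) (λ ()) (λ ())
          (subst (IsWalk Σg _ A) (≡.sym p) wA)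
          (refl , subst (IsWalk Σg _ R) (≡.trans (≡.sym q) (≡.sym r~b)) wR)
          (≡.sym r~b , wB) u

  data WalkThrough (x w z : V Σg) : List (Step Σg) → Set where
    through : ∀ A B → B ≢ [] → IsWalk Σg x A w → IsWalk Σg w B z → WalkThrough x w z (A ++ B)

  walkThrough : ∀ {x w z} W → w ∈ tails W → IsWalk Σg x W z → WalkThrough x w z W
  walkThrough W w∈ w
    with t , t∈W , refl ← ∈-map⁻ (tail Σg) w∈
    with A , B , refl ← ∈-∃++ t∈W
    with _ , wA , (p , wB) ← IsWalk-++⁻ A w =
    through A (t ∷ B) (λ ()) (subst (IsWalk Σg _ A) (≡.sym p) wA) (refl , wB)

  data LastVisit (Vs : List (V Σg)) (x z : V Σg) : List (Step Σg) → Set where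
    lastVisit : ∀ {y} A P → y ∈ Vs → IsWalk Σg x A y → IsWalk Σg y P z →
                (∀ {v} → v ∈ y ∷ heads P → v ∈ Vs → v ≡ y) → LastVisit Vs x z (A ++ P)

  lastVisit? : ∀ Vs {x z} W → IsWalk Σg x W z →
               LastVisit Vs x z W ⊎ (∀ {v} → v ∈ x ∷ heads W → v ∉ Vs)
  lastVisit? Vs {x} [] refl with x ∈ⱽ? Vs
  ... | yes x∈ = inj₁ (lastVisit [] [] x∈ refl refl λ { (here refl) _ → refl })
  ... | no  x∉ = inj₂ λ { (here refl) → x∉ }
  lastVisit? Vs {x} (s ∷ W) (p , w) with lastVisit? Vs W w
  ... | inj₁ (lastVisit A P y∈ wA wP last) = inj₁ (lastVisit (s ∷ A) P y∈ (p , wA) wP last)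
  ... | inj₂ none with x ∈ⱽ? Vs
  ...   | yes x∈ = inj₁ (lastVisit [] (s ∷ W) x∈ refl (p , w)
                          λ { (here refl) _ → refl ; (there v∈) v∈Vs → ⊥-elim (none v∈ v∈Vs) })
  ...   | no  x∉ = inj₂ λ { (here refl) → x∉ ; (there v∈) → none v∈ }

  lastVisitOf : ∀ {Vs x z} W → x ∈ Vs → IsWalk Σg x W z → LastVisit Vs x z W
  lastVisitOf {Vs} W x∈ w with lastVisit? Vs W w
  ... | inj₁ lv   = lv
  ... | inj₂ none = ⊥-elim (none (here refl) x∈)

  looseHandcuff-circuitWalk : ∀ {u r v} Ra Rb Qa P S →
    IsCycleWalk Σg u (Ra ++ Rb) → Unbalanced Σg (Ra ++ Rb) →
    IsWalk Σg u Ra r → IsWalk Σg r Rb u → Rb ≢ [] → IsWalk Σg u Qa r → IsWalk Σg r P v →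
    (∀ {y} → y ∈ r ∷ heads P → y ∈ tails (Ra ++ Rb) → y ≡ r) →
    IsCycleWalk Σg v S → Unbalanced Σg S → Unique (tails ((Qa ++ P) ++ S)) →
    (∀ {y} → y ∈ tails (Ra ++ Rb) → y ∉ tails S) →
    IsCircuitWalk Σg r ((Rb ++ Ra) ++ P ++ S ++ reverseWalk P)
  looseHandcuff-circuitWalk {u} {r} {v} Ra Rb Qa P S cR R-unb wRa wRb Rb≢[] wQa wP onlyLast cS S-unb Q₁S-unique disjoint =
    IsWalk-++ (Rb ++ Ra) (proj₁ cRr) (IsWalk-++ P wP (IsWalk-++ S (proj₁ cS) (IsWalk-reverse P wP))) ,
    inj₂ (inj₂ (r , Rb ++ Ra , v , S , r , P , v , cRr , ≡.trans (walkSign-comm Rb Ra) R-unb , cS , S-unb ,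
                (λ y y∈Rr y∈S → disjoint (∈-tails-comm Rb Ra y∈Rr) y∈S) ,
                (wP , vertices-P , path-edges-unique P wP vertices-P) ,
                cycleWalk-start-∈-tails cRr , cycleWalk-start-∈-tails cS , meet , λ e → occ-handcuff e (Rb ++ Ra) P S))
    where
      cRr : IsCycleWalk Σg r (Rb ++ Ra)
      cRr = IsCycleWalk-rotate Ra Rb cR wRa wRb Rb≢[]
      wQ₁ : IsWalk Σg u (Qa ++ P) v
      wQ₁ = IsWalk-++ Qa wQa wP
      vertices-Q₁ : Unique (tails Qa ++ r ∷ heads P)
      vertices-Q₁ = subst Unique (vertices-++ Qa P wQa)
                      (vertices-unique (Qa ++ P) S wQ₁ Q₁S-unique (cycleWalk-start-∈-tails cS))
      vertices-P : Unique (r ∷ heads P)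
      vertices-P = Unique-++⁻ʳ (tails Qa) vertices-Q₁
      meet : ∀ y → y ∈ r ∷ heads P → (y ∈ tails (Rb ++ Ra) → y ≡ r) × (y ∈ tails S → y ≡ v)
      meet y y∈P = (λ y∈Rr → onlyLast y∈P (∈-tails-comm Rb Ra y∈Rr)) , on-S
        where
          on-S : y ∈ tails S → y ≡ v
          on-S y∈S with ∈-++⁻ (tails (Qa ++ P))
                          (subst (y ∈_) (≡.trans (≡.sym (vertices-++ Qa P wQa)) (tails-heads (Qa ++ P) wQ₁))
                                 (∈-++⁺ʳ (tails Qa) y∈P))
          ... | inj₁ y∈Q₁      = ⊥-elim (Unique-++⇒∉ (tails (Qa ++ P))
                                   (subst Unique (map-++ (tail Σg) (Qa ++ P) S) Q₁S-unique) y∈Q₁ y∈S)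
          ... | inj₂ (here y≡v) = y≡v

-- The value of a walk in G ⋊ {±1}

module WalkValue (Σg : SignedGraph) (ω : Orientation Σg) {c ℓ} (G : AbelianGroup c ℓ)
                 (f : E Σg → AbelianGroup.Carrier G) where

  open Walks Σg
  open SignSemidirect G public
  open AbelianGroup G renaming (refl to ≈-refl; sym to ≈-sym; trans to ≈-trans)
  module GR = Relation.Binary.Reasoning.Setoid setoid
  module GP = Algebra.Properties.Group group
  module ∙-CS = Algebra.Properties.CommutativeSemigroup commutativeSemigroup
  module ⋊ = Group ⋊-group
  module ⋊P = Algebra.Properties.Group ⋊-group
  module ⋊R = Relation.Binary.Reasoning.Setoid ⋊.setoid

  act≡⊙ : ∀ s g → act Σg ω G s g ≡ s ⊙ g
  act≡⊙ pos g = refl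
  act≡⊙ neg g = refl

  wsumFrom-· : ∀ s t W → wsumFrom Σg ω G f (s · t) W ≈ s ⊙ wsumFrom Σg ω G f t W
  wsumFrom-· s t []            = ≈-sym (⊙-ε s)
  wsumFrom-· s t ((e , b) ∷ W) = begin
    act Σg ω G (ω e b · (s · t)) (f e) ∙ wsumFrom Σg ω G f (s · t · σ Σg e) W
      ≈⟨ ∙-cong (reflexive (≡.trans (act≡⊙ (ω e b · (s · t)) (f e)) (cong (_⊙ f e) (·-CS.x∙yz≈y∙xz (ω e b) s t))))
                (reflexive (cong (λ r → wsumFrom Σg ω G f r W) (Sign.*-assoc s t (σ Σg e)))) ⟩
    (s · (ω e b · t)) ⊙ f e ∙ wsumFrom Σg ω G f (s · (t · σ Σg e)) W
      ≈⟨ ∙-cong (⊙-· s _ (f e)) (wsumFrom-· s (t · σ Σg e) W) ⟩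
    s ⊙ (ω e b · t) ⊙ f e ∙ s ⊙ wsumFrom Σg ω G f (t · σ Σg e) W
      ≈⟨ ≈-sym (⊙-homo-∙ s _ _) ⟩
    s ⊙ ((ω e b · t) ⊙ f e ∙ wsumFrom Σg ω G f (t · σ Σg e) W)
      ≈⟨ ⊙-cong s (∙-congʳ (reflexive (≡.sym (act≡⊙ (ω e b · t) (f e))))) ⟩
    s ⊙ (act Σg ω G (ω e b · t) (f e) ∙ wsumFrom Σg ω G f (t · σ Σg e) W)  ∎
    where open GR

  wsumFrom≈⊙wsum : ∀ s W → wsumFrom Σg ω G f s W ≈ s ⊙ wsum Σg ω G f W
  wsumFrom≈⊙wsum s W =
    ≈-trans (reflexive (cong (λ r → wsumFrom Σg ω G f r W) (≡.sym (Sign.*-identityʳ s)))) (wsumFrom-· s pos W)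

  wsum-++ : ∀ A B → wsum Σg ω G f (A ++ B) ≈ wsum Σg ω G f A ∙ walkSign Σg A ⊙ wsum Σg ω G f B
  wsum-++ A B = ≈-trans (wsumFrom-++ pos A) (∙-congˡ (wsumFrom≈⊙wsum _ B))
    where
      wsumFrom-++ : ∀ s A → wsumFrom Σg ω G f s (A ++ B) ≈
                            wsumFrom Σg ω G f s A ∙ wsumFrom Σg ω G f (s · walkSign Σg A) B
      wsumFrom-++ s [] = ≈-trans (reflexive (cong (λ r → wsumFrom Σg ω G f r B) (≡.sym (Sign.*-identityʳ s))))
                                 (≈-sym (identityˡ _))
      wsumFrom-++ s ((e , b) ∷ A) = begin
        x ∙ wsumFrom Σg ω G f t (A ++ B)                                       ≈⟨ ∙-congˡ (wsumFrom-++ t A) ⟩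
        x ∙ (wsumFrom Σg ω G f t A ∙ wsumFrom Σg ω G f (t · walkSign Σg A) B)  ≈⟨ ≈-sym (assoc _ _ _) ⟩
        x ∙ wsumFrom Σg ω G f t A ∙ wsumFrom Σg ω G f (t · walkSign Σg A) B    ≈⟨ ∙-congˡ (reflexive (cong
                                                                                    (λ r → wsumFrom Σg ω G f r B)
                                                                                    (Sign.*-assoc s (σ Σg e) _))) ⟩
        x ∙ wsumFrom Σg ω G f t A ∙ wsumFrom Σg ω G f (s · (σ Σg e · walkSign Σg A)) B  ∎
        where
          open GR
          x : Carrier
          x = act Σg ω G (ω e b · s) (f e)
          t : Sign
          t = s · σ Σg e

  ⟦_⟧ : List (Step Σg) → Element
  ⟦ W ⟧ = wsum Σg ω G f W , walkSign Σg W

  ⟦⟧-++ : ∀ A B → ⟦ A ++ B ⟧ ≋ ⟦ A ⟧ ⊗ ⟦ B ⟧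
  ⟦⟧-++ A B = wsum-++ A B , walkSign-++ A B

  -- Compatibility of ω with σ is exactly what makes traversing an edge
  -- backwards the inverse of traversing it forwards.
  module Reversal (compatible : Compatible Σg ω) where

    ⟦⟧-flipStep : ∀ s → ⟦ [ flipStep s ] ⟧ ≋ ⟦ [ s ] ⟧ ⁻¹⋊
    ⟦⟧-flipStep (e , b) = ⋊.trans (⟦⟧-step e (not b)) (⋊.trans flipped (⋊.⁻¹-cong (⋊.sym (⟦⟧-step e b))))
      where
        ⟦⟧-step : ∀ e b → ⟦ [ (e , b) ] ⟧ ≋ (ω e b ⊙ f e , σ Σg e)
        ⟦⟧-step e b = ≈-trans (identityʳ _)
          (reflexive (≡.trans (act≡⊙ (ω e b · pos) (f e)) (cong (_⊙ f e) (Sign.*-identityʳ (ω e b)))))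
                    , Sign.*-identityʳ _
        σ-ω : ∀ b → σ Σg e · (neg · ω e b) ≡ ω e (not b)
        σ-ω false rewrite compatible e = opposite[x·y]·opposite[x]≡y (ω e false) (ω e true)
        σ-ω true  rewrite compatible e | Sign.*-comm (ω e false) (ω e true) =
          opposite[x·y]·opposite[x]≡y (ω e true) (ω e false)
        flipped : (ω e (not b) ⊙ f e , σ Σg e) ≋ (σ Σg e ⊙ ((ω e b ⊙ f e) ⁻¹) , σ Σg e)
        flipped = (begin
          ω e (not b) ⊙ f e                 ≈⟨ reflexive (cong (_⊙ f e) (≡.sym (σ-ω b))) ⟩
          (σ Σg e · (neg · ω e b)) ⊙ f e    ≈⟨ ⊙-· (σ Σg e) _ (f e) ⟩
          σ Σg e ⊙ (neg · ω e b) ⊙ f e      ≈⟨ ⊙-cong (σ Σg e) (⊙-· neg (ω e b) (f e)) ⟩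
          σ Σg e ⊙ ((ω e b ⊙ f e) ⁻¹)       ∎) , refl
          where open GR

    ⟦⟧-reverse : ∀ W → ⟦ reverseWalk W ⟧ ≋ ⟦ W ⟧ ⁻¹⋊
    ⟦⟧-reverse []      = ⋊.sym ⋊P.ε⁻¹≈ε
    ⟦⟧-reverse (s ∷ W) = begin
      ⟦ reverseWalk W ++ [ flipStep s ] ⟧         ≈⟨ ⟦⟧-++ (reverseWalk W) [ flipStep s ] ⟩
      ⟦ reverseWalk W ⟧ ⊗ ⟦ [ flipStep s ] ⟧      ≈⟨ ⋊.∙-cong (⟦⟧-reverse W) (⟦⟧-flipStep s) ⟩
      ⟦ W ⟧ ⁻¹⋊ ⊗ ⟦ [ s ] ⟧ ⁻¹⋊                  ≈⟨ ⋊.sym (⋊P.⁻¹-anti-homo-∙ ⟦ [ s ] ⟧ ⟦ W ⟧) ⟩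
      (⟦ [ s ] ⟧ ⊗ ⟦ W ⟧) ⁻¹⋊                    ≈⟨ ⋊.⁻¹-cong (⋊.sym (⟦⟧-++ [ s ] W)) ⟩
      ⟦ s ∷ W ⟧ ⁻¹⋊                              ∎
      where open ⋊R

    ⟦⟧-backtrack : ∀ s → ⟦ s ∷ flipStep s ∷ [] ⟧ ≋ 1⋊
    ⟦⟧-backtrack s = ⋊.trans (⟦⟧-++ [ s ] [ flipStep s ])
      (⋊.trans (⋊.∙-congˡ {⟦ [ s ] ⟧} (⟦⟧-flipStep s)) (⋊.inverseʳ ⟦ [ s ] ⟧))

    ⟦⟧-reverse-unbalanced : ∀ W → Unbalanced Σg W → ⟦ reverseWalk W ⟧ ≋ ⟦ W ⟧
    ⟦⟧-reverse-unbalanced W unb with ⟦⟧-reverse W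
    ... | rev rewrite unb = ⋊.trans rev (GP.⁻¹-involutive _ , refl)

  ⟦⟧-++ʳ : ∀ A {B y} → ⟦ B ⟧ ≋ y → ⟦ A ++ B ⟧ ≋ ⟦ A ⟧ ⊗ y
  ⟦⟧-++ʳ A {B} B≈y = ⋊.trans (⟦⟧-++ A B) (⋊.∙-congˡ {⟦ A ⟧} B≈y)

  ⟦⟧-rotate : ∀ A B → ⟦ A ++ B ⟧ ≋ 1⋊ → ⟦ B ++ A ⟧ ≋ 1⋊
  ⟦⟧-rotate A B AB≈1 = begin
    ⟦ B ++ A ⟧         ≈⟨ ⟦⟧-++ B A ⟩
    ⟦ B ⟧ ⊗ ⟦ A ⟧      ≈⟨ ⋊.∙-congʳ (⋊P.inverseʳ-unique ⟦ A ⟧ ⟦ B ⟧ (⋊.trans (⋊.sym (⟦⟧-++ A B)) AB≈1)) ⟩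
    ⟦ A ⟧ ⁻¹⋊ ⊗ ⟦ A ⟧  ≈⟨ ⋊.inverseˡ ⟦ A ⟧ ⟩
    1⋊                 ∎
    where open ⋊R

  ⟦⟧-cong-middle : ∀ A {M M′} C → ⟦ M ⟧ ≋ ⟦ M′ ⟧ → ⟦ A ++ M ++ C ⟧ ≋ ⟦ A ++ M′ ++ C ⟧
  ⟦⟧-cong-middle A {M} {M′} C M≈M′ = begin
    ⟦ A ++ M ++ C ⟧            ≈⟨ ⟦⟧-++ A (M ++ C) ⟩
    ⟦ A ⟧ ⊗ ⟦ M ++ C ⟧         ≈⟨ ⋊.∙-congˡ {⟦ A ⟧} (⋊.trans (⟦⟧-++ M C)
                                    (⋊.trans (⋊.∙-congʳ {⟦ C ⟧} M≈M′) (⋊.sym (⟦⟧-++ M′ C)))) ⟩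
    ⟦ A ⟧ ⊗ ⟦ M′ ++ C ⟧        ≈⟨ ⋊.sym (⟦⟧-++ A (M′ ++ C)) ⟩
    ⟦ A ++ M′ ++ C ⟧           ∎
    where open ⋊R

  In2G-cong : ∀ {x y} → x ≈ y → In2G Σg ω G x → In2G Σg ω G y
  In2G-cong x≈y (d , dd≈x) = d , ≈-trans dd≈x x≈y

  In2G-∙ : ∀ {x y} → In2G Σg ω G x → In2G Σg ω G y → In2G Σg ω G (x ∙ y)
  In2G-∙ (d , dd≈x) (d′ , d′d′≈y) = d ∙ d′ , ≈-trans (∙-CS.interchange d d′ d d′) (∙-cong dd≈x d′d′≈y)

  plainSum-++ : ∀ A B → plainSum Σg ω G f (A ++ B) ≈ plainSum Σg ω G f A ∙ plainSum Σg ω G f B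
  plainSum-++ []            B = ≈-sym (identityˡ _)
  plainSum-++ ((e , _) ∷ A) B = ≈-trans (∙-congˡ (plainSum-++ A B)) (≈-sym (assoc (f e) _ _))

  plainSum-++-middle : ∀ A M C →
    plainSum Σg ω G f (A ++ M ++ C) ≈ plainSum Σg ω G f M ∙ plainSum Σg ω G f (A ++ C)
  plainSum-++-middle A M C = begin
    plainSum Σg ω G f (A ++ M ++ C)                                     ≈⟨ ≈-trans (plainSum-++ A _)
                                                                           (∙-congˡ (plainSum-++ M C)) ⟩
    plainSum Σg ω G f A ∙ (plainSum Σg ω G f M ∙ plainSum Σg ω G f C)  ≈⟨ ∙-CS.x∙yz≈y∙xz _ _ _ ⟩
    plainSum Σg ω G f M ∙ (plainSum Σg ω G f A ∙ plainSum Σg ω G f C)  ≈⟨ ∙-congˡ (≈-sym (plainSum-++ A C)) ⟩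
    plainSum Σg ω G f M ∙ plainSum Σg ω G f (A ++ C)                    ∎
    where open GR

  -- Acting by a sign changes an element only by a double, since g ≈ g ⁻¹ ∙ (g ∙ g).
  plainSum≈wsumFrom∙double : ∀ s W → ∃ λ d → plainSum Σg ω G f W ≈ wsumFrom Σg ω G f s W ∙ (d ∙ d)
  plainSum≈wsumFrom∙double s []            = ε , ≈-sym (≈-trans (identityˡ _) (identityˡ ε))
  plainSum≈wsumFrom∙double s ((e , b) ∷ W) =
    let d , eq = plainSum≈wsumFrom∙double (s · σ Σg e) W
        k , eqₑ = step (ω e b · s)
    in k ∙ d , ≈-trans (∙-cong eqₑ eq) (≈-trans (∙-CS.interchange _ (k ∙ k) _ (d ∙ d))
                                                 (∙-congˡ (≈-sym (∙-CS.interchange k d k d))))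
    where
      step : ∀ t → ∃ λ k → f e ≈ act Σg ω G t (f e) ∙ (k ∙ k)
      step pos = ε , ≈-sym (≈-trans (∙-congˡ (identityˡ ε)) (identityʳ (f e)))
      step neg = f e , ≈-sym (≈-trans (≈-sym (assoc _ _ _)) (≈-trans (∙-congʳ (inverseˡ (f e))) (identityˡ (f e))))

  wsum≈ε⇒In2G-plainSum : ∀ W → wsum Σg ω G f W ≈ ε → In2G Σg ω G (plainSum Σg ω G f W)
  wsum≈ε⇒In2G-plainSum W wsum≈ε =
    let d , eq = plainSum≈wsumFrom∙double pos W
    in d , ≈-sym (≈-trans eq (≈-trans (∙-congʳ wsum≈ε) (identityˡ (d ∙ d))))

-- Closed walks under a tension

module ClosedWalks (Σg : SignedGraph) (ω : Orientation Σg) (compatible : Compatible Σg ω)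
                   {c ℓ} (G : AbelianGroup c ℓ) (f : E Σg → AbelianGroup.Carrier G)
                   (tension : IsTension Σg ω G f) where

  open Walks Σg
  open ClosedWalkDecomposition Σg
  open WalkValue Σg ω G f
  open Reversal compatible
  open AbelianGroup G using () renaming (sym to ≈-sym)

  module GF = GroupFacts ⋊-group
  module ↭ = Algebra.Solver.CommutativeMonoid (++-commutativeMonoid {A = Step Σg})
  open ↭ using (_⊕_; _⊜_)

  walks : Monoid 0ℓ 0ℓ
  walks = ++-monoid (Step Σg)

  ⟦⟧-circuitWalk : ∀ {v} W → IsCircuitWalk Σg v W → ⟦ W ⟧ ≋ 1⋊
  ⟦⟧-circuitWalk W cw = tension _ W cw , circuitWalk-balanced W cw

  ⟦⟧-simpleClosedWalk : ∀ {x W} → SimpleClosedWalk x W → Balanced Σg W → ⟦ W ⟧ ≋ 1⋊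
  ⟦⟧-simpleClosedWalk {W = W} (cycle cw) W-bal =
    ⟦⟧-circuitWalk W (proj₁ cw , inj₁ (_ , W , cw , W-bal , λ _ → refl))
  ⟦⟧-simpleClosedWalk (backtrack s) _ = ⟦⟧-backtrack s

  ⟦⟧-distinctVertices : ∀ {x} W → IsWalk Σg x W x → Unique (tails W) → Balanced Σg W → ⟦ W ⟧ ≋ 1⋊
  ⟦⟧-distinctVertices []          _ _    _     = ⋊.refl
  ⟦⟧-distinctVertices W@(_ ∷ _)   w W-ts W-bal = ⟦⟧-simpleClosedWalk (simpleClosedWalk W (λ ()) w W-ts) W-bal

  BalancedBelow : ℕ → Set ℓ
  BalancedBelow n = ∀ {x} W → IsWalk Σg x W x → Balanced Σg W → length W < n → ⟦ W ⟧ ≋ 1⋊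

  ⟦⟧-balanced-split : ∀ {w} X Y → BalancedBelow (length (X ++ Y)) → X ≢ [] → Y ≢ [] →
                      IsWalk Σg w X w → IsWalk Σg w Y w → Balanced Σg (X ++ Y) → Balanced Σg X →
                      ⟦ X ++ Y ⟧ ≋ 1⋊
  ⟦⟧-balanced-split X Y ih X≢[] Y≢[] wX wY XY-bal X-bal = begin
    ⟦ X ++ Y ⟧     ≈⟨ ⟦⟧-++ X Y ⟩
    ⟦ X ⟧ ⊗ ⟦ Y ⟧  ≈⟨ ⋊.∙-cong (ih X wX X-bal (length-<-++ʳ X Y≢[])) (ih Y wY Y-bal (length-<-++ˡ Y X≢[])) ⟩
    1⋊ ⊗ 1⋊        ≈⟨ ⋊.identityˡ 1⋊ ⟩
    1⋊             ∎
    where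
      open ⋊R
      Y-bal : Balanced Σg Y
      Y-bal = ≡.trans (cong (_· walkSign Σg Y) (≡.sym X-bal)) (≡.trans (≡.sym (walkSign-++ X Y)) XY-bal)

  -- The closed walk P (S₁ S₂) T at w is the product of the closed walks P S₁ and S₂ T, and,
  -- since the unbalanced S₁ S₂ may be traversed backwards, also of P S₂⁻¹ and S₁⁻¹ T.
  -- One of these two splittings is into balanced walks.
  ⟦⟧-figureEight : ∀ {w v} P S₁ S₂ T → BalancedBelow (length (P ++ (S₁ ++ S₂) ++ T)) →
    P ≢ [] → S₂ ≢ [] → reverseWalk S₁ ++ T ≢ [] →
    IsWalk Σg w P v → IsWalk Σg v S₁ w → IsWalk Σg w S₂ v → IsWalk Σg v T w →
    Unbalanced Σg (S₁ ++ S₂) → Balanced Σg (P ++ (S₁ ++ S₂) ++ T) → ⟦ P ++ (S₁ ++ S₂) ++ T ⟧ ≋ 1⋊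
  ⟦⟧-figureEight P S₁ S₂ T ih P≢[] S₂≢[] Y′≢[] wP wS₁ wS₂ wT S-unb V-bal
    with walkSign Σg (P ++ S₁) in X-bal
  ... | pos = subst (λ V → ⟦ V ⟧ ≋ 1⋊) (≡.sym split≡)
      (⟦⟧-balanced-split (P ++ S₁) (S₂ ++ T) (subst BalancedBelow (cong length split≡) ih)
        (++≢[]ˡ S₁ P≢[]) (++≢[]ˡ T S₂≢[]) (IsWalk-++ P wP wS₁) (IsWalk-++ S₂ wS₂ wT)
        (subst (Balanced Σg) split≡ V-bal) X-bal)
    where
      split≡ : P ++ (S₁ ++ S₂) ++ T ≡ (P ++ S₁) ++ (S₂ ++ T)
      split≡ = solve walks
  ... | neg = ⋊.trans reversed (subst (λ V → ⟦ V ⟧ ≋ 1⋊) (≡.sym split≡)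
      (⟦⟧-balanced-split (P ++ reverseWalk S₂) (reverseWalk S₁ ++ T) ih′ (++≢[]ˡ _ P≢[]) Y′≢[]
        (IsWalk-++ P wP (IsWalk-reverse S₂ wS₂)) (IsWalk-++ (reverseWalk S₁) (IsWalk-reverse S₁ wS₁) wT)
        (subst (Balanced Σg) split≡ (≡.trans (≡.sym (proj₂ reversed)) V-bal)) X′-bal))
    where
      M′ : List (Step Σg)
      M′ = reverseWalk S₂ ++ reverseWalk S₁
      reversed : ⟦ P ++ (S₁ ++ S₂) ++ T ⟧ ≋ ⟦ P ++ M′ ++ T ⟧
      reversed = ⟦⟧-cong-middle P {S₁ ++ S₂} {M′} T (⋊.sym (subst (λ M → ⟦ M ⟧ ≋ ⟦ S₁ ++ S₂ ⟧) (reverseWalk-++ S₁ S₂)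
                                                               (⟦⟧-reverse-unbalanced (S₁ ++ S₂) S-unb)))
      split≡ : P ++ M′ ++ T ≡ (P ++ reverseWalk S₂) ++ (reverseWalk S₁ ++ T)
      split≡ = solve walks
      length-M′ : length (S₁ ++ S₂) ≡ length M′
      length-M′ = ≡.trans (≡.sym (length-reverseWalk (S₁ ++ S₂))) (cong length (reverseWalk-++ S₁ S₂))
      ih′ : BalancedBelow (length ((P ++ reverseWalk S₂) ++ (reverseWalk S₁ ++ T)))
      ih′ = subst BalancedBelow (≡.trans (length-++-middle P T length-M′) (cong length split≡)) ih
      X′-bal : Balanced Σg (P ++ reverseWalk S₂)
      X′-bal = ≡.trans (walkSign-++ P (reverseWalk S₂)) (≡.trans (cong (walkSign Σg P ·_) (walkSign-reverse S₂))
                 (x·y≡-⇒y·z≡-⇒x·z≡+ (walkSign Σg P) (walkSign Σg S₁) (walkSign Σg S₂)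
                   (≡.trans (≡.sym (walkSign-++ P S₁)) X-bal) (≡.trans (≡.sym (walkSign-++ S₁ S₂)) S-unb)))

  ⟦⟧-sharedVertex : ∀ {u v w} R Q₁ S Q₂ → BalancedBelow (length (R ++ Q₁ ++ S ++ Q₂)) →
    IsWalk Σg u R u → IsWalk Σg u Q₁ v → IsWalk Σg v S v → IsWalk Σg v Q₂ u →
    Unbalanced Σg S → Balanced Σg (R ++ Q₁ ++ S ++ Q₂) →
    w ∈ tails R → w ∈ tails S → w ≢ u ⊎ Q₂ ≢ [] → ⟦ R ++ Q₁ ++ S ++ Q₂ ⟧ ≋ 1⋊
  ⟦⟧-sharedVertex R Q₁ S Q₂ ih wR wQ₁ wS wQ₂ S-unb W-bal w∈R w∈S nontrivial
    with walkThrough R w∈R wR | walkThrough S w∈S wS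
  ... | through R₁ R₂ R₂≢[] wR₁ wR₂ | through S₁ S₂ S₂≢[] wS₁ wS₂ =
    subst (λ W → ⟦ W ⟧ ≋ 1⋊) (≡.sym W≡R₁V₀) (⟦⟧-rotate V₀ R₁ (subst (λ V → ⟦ V ⟧ ≋ 1⋊) (≡.sym V≡)
      (⟦⟧-figureEight (R₂ ++ Q₁) S₁ S₂ (Q₂ ++ R₁) (subst BalancedBelow (≡.sym length-V) ih)
        (++≢[]ˡ Q₁ R₂≢[]) S₂≢[] Y′≢[] (IsWalk-++ R₂ wR₂ wQ₁) wS₁ wS₂ (IsWalk-++ Q₂ wQ₂ wR₁)
        S-unb V-bal)))
    where
      V₀ : List (Step Σg)
      V₀ = R₂ ++ Q₁ ++ S₁ ++ S₂ ++ Q₂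
      W≡R₁V₀ : ((R₁ ++ R₂) ++ Q₁ ++ (S₁ ++ S₂) ++ Q₂) ≡ R₁ ++ V₀
      W≡R₁V₀ = solve walks
      V≡ : V₀ ++ R₁ ≡ (R₂ ++ Q₁) ++ (S₁ ++ S₂) ++ (Q₂ ++ R₁)
      V≡ = solve walks
      length-V : length ((R₂ ++ Q₁) ++ (S₁ ++ S₂) ++ (Q₂ ++ R₁)) ≡ length ((R₁ ++ R₂) ++ Q₁ ++ (S₁ ++ S₂) ++ Q₂)
      length-V = ≡.trans (cong length (≡.sym V≡))
                   (≡.trans (length-++-comm V₀ R₁) (cong length (≡.sym W≡R₁V₀)))
      V-bal : Balanced Σg ((R₂ ++ Q₁) ++ (S₁ ++ S₂) ++ (Q₂ ++ R₁))
      V-bal = ≡.trans (cong (walkSign Σg) (≡.sym V≡))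
                (≡.trans (walkSign-comm V₀ R₁) (≡.trans (cong (walkSign Σg) (≡.sym W≡R₁V₀)) W-bal))
      -- If S₁, Q₂ and R₁ were all empty, then w = v = u and Q₂ = [], against the last hypothesis.
      Y′≢[] : reverseWalk S₁ ++ Q₂ ++ R₁ ≢ []
      Y′≢[] Y′≡[] with reverseWalk≡[]⇒≡[] S₁ (++-conicalˡ (reverseWalk S₁) _ Y′≡[])
                     | ++-conicalˡ Q₂ R₁ (++-conicalʳ (reverseWalk S₁) _ Y′≡[])
                     | ++-conicalʳ Q₂ R₁ (++-conicalʳ (reverseWalk S₁) _ Y′≡[])
      ... | refl | refl | refl = [ (λ w≢u → w≢u (≡.sym wR₁)) , (λ Q₂≢[] → Q₂≢[] refl) ]′ nontrivial

  ⟦⟧-tightHandcuff : ∀ {u} R S → IsCycleWalk Σg u R → Unbalanced Σg R →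
                     IsCycleWalk Σg u S → Unbalanced Σg S →
                     (∀ {v} → v ∈ tails R → v ∈ tails S → v ≡ u) → ⟦ R ++ S ⟧ ≋ 1⋊
  ⟦⟧-tightHandcuff {u} R S cR R-unb cS S-unb meet
    with common? _≟ᶠ_ (λ _ → ⊤) (λ _ → yes tt) (edges Σg R) (edges Σg S)
  ... | inj₂ disjoint = ⟦⟧-circuitWalk (R ++ S) (IsWalk-++ R (proj₁ cR) (proj₁ cS) ,
          inj₂ (inj₁ (u , R , u , S , cR , R-unb , cS , S-unb ,
            (u , λ _ → (λ (y∈R , y∈S) → meet y∈R y∈S)
                     , λ { refl → cycleWalk-start-∈-tails cR , cycleWalk-start-∈-tails cS }) ,
            edge-disjoint , λ e → occ-++ e R S)))
    where
      edge-disjoint : ∀ e → occ Σg e R ≡ 0 ⊎ occ Σg e S ≡ 0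
      edge-disjoint e with occ Σg e R ℕ.≟ 0 | occ Σg e S ℕ.≟ 0
      ... | yes R∌e | _       = inj₁ R∌e
      ... | _       | yes S∌e = inj₂ S∌e
      ... | no R∋e  | no S∋e  = ⊥-elim (disjoint (occ≢0⇒∈ e R R∋e) (occ≢0⇒∈ e S S∋e) tt)
  ... | inj₁ (e , e∈R , e∈S , _)
    with (_ , d) , t∈R , refl ← ∈-map⁻ proj₁ e∈R
    with (_ , d′) , t′∈S , refl ← ∈-map⁻ proj₁ e∈S
    with refl , refl ← sharedEdge-loop R S cR cS meet t∈R t′∈S
    with d′ ≟ᵇ d
  ... | yes refl = ⋊.trans (⟦⟧-cong-middle [ (e , d) ] {[ (e , d) ]} {[ (e , not d) ]} []
                             (⋊.sym (⟦⟧-reverse-unbalanced [ (e , d) ] R-unb)))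
                           (⟦⟧-backtrack (e , d))
  ... | no d′≢d with refl ← ¬-not d′≢d = ⟦⟧-backtrack (e , d)

  -- Depending on the sign of Q R, one of the closed walks Q R⁻¹ and Q R′ is balanced.
  ⟦⟧-chord : ∀ {n u r} Q R R′ → BalancedBelow n →
    IsWalk Σg u Q r → IsWalk Σg u R r → IsWalk Σg r R′ u → Unbalanced Σg (R ++ R′) →
    length (Q ++ reverseWalk R) < n → length (Q ++ R′) < n → ⟦ Q ⟧ ≋ ⟦ R ⟧ ⊎ ⟦ Q ⟧ ⊗ ⟦ R′ ⟧ ≋ 1⋊
  ⟦⟧-chord Q R R′ ih wQ wR wR′ RR′-unb shorter shorter′ with walkSign Σg Q · walkSign Σg R in QR-sign
  ... | pos = inj₁ (⋊P.x∙y⁻¹≈ε⇒x≈y ⟦ Q ⟧ ⟦ R ⟧ (⋊.trans (⋊.sym (⟦⟧-++ʳ Q (⟦⟧-reverse R)))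
        (ih (Q ++ reverseWalk R) (IsWalk-++ Q wQ (IsWalk-reverse R wR))
          (≡.trans (walkSign-++ Q _) (≡.trans (cong (walkSign Σg Q ·_) (walkSign-reverse R)) QR-sign)) shorter)))
  ... | neg = inj₂ (⋊.trans (⋊.sym (⟦⟧-++ Q R′))
        (ih (Q ++ R′) (IsWalk-++ Q wQ wR′)
          (≡.trans (walkSign-++ Q R′) (x·y≡-⇒y·z≡-⇒x·z≡+ (walkSign Σg Q) (walkSign Σg R) (walkSign Σg R′)
            QR-sign (≡.trans (≡.sym (walkSign-++ R R′)) RR′-unb)))
          shorter′))

  -- r is the last vertex of the connecting walk Qa P on R = Ra Rb, so the closed walk is
  -- (Ra Rb) (Qa P) S Q₂; the loose handcuff is Rb Ra P S P⁻¹.  Comparing Qa with Ra (or Rb)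
  -- and Qa P with Q₂⁻¹ by shorter balanced closed walks leaves a conjugate of the handcuff.
  ⟦⟧-looseHandcuff : ∀ {u v} R Q₁ S Q₂ → BalancedBelow (length (R ++ Q₁ ++ S ++ Q₂)) →
    IsCycleWalk Σg u R → Unbalanced Σg R → IsWalk Σg u Q₁ v →
    IsCycleWalk Σg v S → Unbalanced Σg S → IsWalk Σg v Q₂ u →
    Balanced Σg (Q₁ ++ Q₂) → Unique (tails (Q₁ ++ S)) → (∀ {y} → y ∈ tails R → y ∉ tails S) →
    ⟦ R ++ Q₁ ++ S ++ Q₂ ⟧ ≋ 1⋊
  ⟦⟧-looseHandcuff R Q₁ S Q₂ ih cR R-unb wQ₁ cS S-unb wQ₂ Q-bal Q₁S-unique disjoint
    with lastVisitOf Q₁ (cycleWalk-start-∈-tails cR) wQ₁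
  ... | lastVisit Qa P r∈R wQa wP onlyLast
    with walkThrough R r∈R (proj₁ cR)
  ... | through Ra Rb Rb≢[] wRa wRb =
    subst (λ W → ⟦ W ⟧ ≋ 1⋊) (≡.sym W≡)
      (⋊.trans (⟦⟧-++ʳ Ra (⟦⟧-++ʳ Rb (⟦⟧-++ʳ Qa (⟦⟧-++ʳ P (⟦⟧-++ S Q₂)))))
        (GF.looseHandcuff-≈ε ⟦ Ra ⟧ ⟦ Rb ⟧ ⟦ Qa ⟧ ⟦ P ⟧ ⟦ S ⟧ ⟦ reverseWalk P ⟧ ⟦ Q₂ ⟧
          P-back handcuff closed returns))
    where
      W≡ : (Ra ++ Rb) ++ (Qa ++ P) ++ S ++ Q₂ ≡ Ra ++ Rb ++ Qa ++ P ++ S ++ Q₂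
      W≡ = solve walks
      P-back : ⟦ P ⟧ ⊗ ⟦ reverseWalk P ⟧ ≋ 1⋊
      P-back = ⋊.trans (⋊.∙-congˡ {⟦ P ⟧} (⟦⟧-reverse P)) (⋊.inverseʳ ⟦ P ⟧)
      handcuff : ⟦ Rb ⟧ ⊗ (⟦ Ra ⟧ ⊗ (⟦ P ⟧ ⊗ (⟦ S ⟧ ⊗ ⟦ reverseWalk P ⟧))) ≋ 1⋊
      handcuff = ⋊.trans (⋊.sym (⟦⟧-++ʳ Rb (⟦⟧-++ʳ Ra (⟦⟧-++ʳ P (⟦⟧-++ S (reverseWalk P))))))
        (subst (λ W → ⟦ W ⟧ ≋ 1⋊) (++-assoc Rb Ra _)
          (⟦⟧-circuitWalk _ (looseHandcuff-circuitWalk Ra Rb Qa P S cR R-unb wRa wRb Rb≢[] wQa wP onlyLast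
                                                         cS S-unb Q₁S-unique disjoint)))
      closed : ⟦ Qa ⟧ ⊗ (⟦ P ⟧ ⊗ ⟦ Q₂ ⟧) ≋ 1⋊
      closed = ⋊.trans (⋊.sym (⟦⟧-++ʳ Qa (⟦⟧-++ P Q₂)))
        (ih (Qa ++ P ++ Q₂) (IsWalk-++ Qa wQa (IsWalk-++ P wP wQ₂))
            (subst (Balanced Σg) (++-assoc Qa P Q₂) Q-bal)
            (length-<-↭ {xs = Qa ++ P ++ Q₂} {ys = Ra ++ Rb ++ S} (++≢[]ʳ Ra (++≢[]ˡ S Rb≢[]))
              (↭.solve 6 (λ ra rb qa p s q₂ → (qa ⊕ p ⊕ q₂) ⊕ (ra ⊕ rb ⊕ s) ⊜ (ra ⊕ rb) ⊕ (qa ⊕ p) ⊕ s ⊕ q₂)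
                 ↭-refl Ra Rb Qa P S Q₂)))
      returns : ⟦ Qa ⟧ ≋ ⟦ Ra ⟧ ⊎ ⟦ Qa ⟧ ⊗ ⟦ Rb ⟧ ≋ 1⋊
      returns = ⟦⟧-chord Qa Ra Rb ih wQa wRa wRb R-unb
        (subst (_< length ((Ra ++ Rb) ++ (Qa ++ P) ++ S ++ Q₂)) (≡.sym (length-++-reverseWalk Qa Ra))
          (length-<-↭ {xs = Qa ++ Ra} {ys = Rb ++ P ++ S ++ Q₂} (++≢[]ˡ (P ++ S ++ Q₂) Rb≢[])
            (↭.solve 6 (λ ra rb qa p s q₂ → (qa ⊕ ra) ⊕ (rb ⊕ p ⊕ s ⊕ q₂) ⊜ (ra ⊕ rb) ⊕ (qa ⊕ p) ⊕ s ⊕ q₂)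
               ↭-refl Ra Rb Qa P S Q₂)))
        (length-<-↭ {xs = Qa ++ Rb} {ys = Ra ++ P ++ S ++ Q₂} (++≢[]ʳ Ra (++≢[]ʳ P (++≢[]ˡ Q₂ (cycleWalk-≢[] cS))))
          (↭.solve 6 (λ ra rb qa p s q₂ → (qa ⊕ rb) ⊕ (ra ⊕ p ⊕ s ⊕ q₂) ⊜ (ra ⊕ rb) ⊕ (qa ⊕ p) ⊕ s ⊕ q₂)
             ↭-refl Ra Rb Qa P S Q₂))

  ⟦⟧-twoCycles : ∀ {u v} R Q₁ S Q₂ → BalancedBelow (length (R ++ Q₁ ++ S ++ Q₂)) →
    IsCycleWalk Σg u R → Unbalanced Σg R → IsWalk Σg u Q₁ v →
    IsCycleWalk Σg v S → Unbalanced Σg S → IsWalk Σg v Q₂ u → Q₂ ≢ [] →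
    Balanced Σg (Q₁ ++ Q₂) → Unique (tails (Q₁ ++ S)) → ⟦ R ++ Q₁ ++ S ++ Q₂ ⟧ ≋ 1⋊
  ⟦⟧-twoCycles R Q₁ S Q₂ ih cR R-unb wQ₁ cS S-unb wQ₂ Q₂≢[] Q-bal Q₁S-unique
    with common? _≟ᶠ_ (λ _ → ⊤) (λ _ → yes tt) (tails R) (tails S)
  ... | inj₁ (_ , w∈R , w∈S , _) =
    ⟦⟧-sharedVertex R Q₁ S Q₂ ih (proj₁ cR) wQ₁ (proj₁ cS) wQ₂ S-unb
      (handcuffWalk-balanced R Q₁ S Q₂ R-unb S-unb Q-bal) w∈R w∈S (inj₂ Q₂≢[])
  ... | inj₂ disjoint =
    ⟦⟧-looseHandcuff R Q₁ S Q₂ ih cR R-unb wQ₁ cS S-unb wQ₂ Q-bal Q₁S-unique (λ y∈R y∈S → disjoint y∈R y∈S tt)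

  ⟦⟧-twoUnbalancedCycles : ∀ {y} R Q → BalancedBelow (length (R ++ Q)) →
    IsCycleWalk Σg y R → Unbalanced Σg R → IsCycleWalk Σg y Q → Unbalanced Σg Q → ⟦ R ++ Q ⟧ ≋ 1⋊
  ⟦⟧-twoUnbalancedCycles {y} R Q ih cR R-unb cQ Q-unb
    with common? _≟ᶠ_ (_≢ y) (λ w → ¬? (w ≟ᶠ y)) (tails R) (tails Q)
  ... | inj₁ (_ , w∈R , w∈Q , w≢y) =
    subst (λ W → ⟦ W ⟧ ≋ 1⋊) (cong (R ++_) (++-identityʳ Q))
      (⟦⟧-sharedVertex R [] Q [] (subst BalancedBelow (cong (λ W → length (R ++ W)) (≡.sym (++-identityʳ Q))) ih)
        (proj₁ cR) refl (proj₁ cQ) refl Q-unb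
        (handcuffWalk-balanced R [] Q [] R-unb Q-unb refl)
        w∈R w∈Q (inj₁ w≢y))
  ... | inj₂ only-y = ⟦⟧-tightHandcuff R Q cR R-unb cQ Q-unb
                        λ {v} v∈R v∈Q → decidable-stable (v ≟ᶠ y) (only-y v∈R v∈Q)

  ⟦⟧-unbalancedCycle-++ : ∀ {y} R Q → BalancedBelow (length (R ++ Q)) →
    IsCycleWalk Σg y R → Unbalanced Σg R → IsWalk Σg y Q y → Unbalanced Σg Q → ⟦ R ++ Q ⟧ ≋ 1⋊
  ⟦⟧-unbalancedCycle-++ R Q ih cR R-unb wQ Q-unb with closedWalkSplit Q wQ
  ... | simple Q-ts = ⟦⟧-twoUnbalancedCycles R Q ih cR R-unb
    (simpleClosedWalk-unbalanced (simpleClosedWalk Q (unbalanced-≢[] Q-unb) wQ Q-ts) Q-unb) Q-unb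
  ⟦⟧-unbalancedCycle-++ R _ ih cR R-unb _ Q-unb | split A S B S≢[] B≢[] wA wS wB AS-ts
    with walkSign Σg S in S-sign
  ... | pos = ⋊.trans (subst (λ W → ⟦ W ⟧ ≋ ⟦ R ++ A ++ B ⟧) (++-assoc R A (S ++ B)) dropS)
               (ih (R ++ A ++ B) (IsWalk-++ R (proj₁ cR) (IsWalk-++ A wA wB)) RAB-bal
                   (length-<-↭ {xs = R ++ A ++ B} {ys = S} S≢[]
                     (↭.solve 4 (λ r a s b → (r ⊕ a ⊕ b) ⊕ s ⊜ r ⊕ a ⊕ s ⊕ b) ↭-refl R A S B)))
    where
      S-trivial : ⟦ S ⟧ ≋ 1⋊
      S-trivial = ⟦⟧-simpleClosedWalk (simpleClosedWalk S S≢[] wS (tails-suffix-unique A S AS-ts)) S-sign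
      dropS : ⟦ (R ++ A) ++ S ++ B ⟧ ≋ ⟦ R ++ A ++ B ⟧
      dropS = subst (λ W → ⟦ (R ++ A) ++ S ++ B ⟧ ≋ ⟦ W ⟧) (++-assoc R A B)
                    (⟦⟧-cong-middle (R ++ A) {S} {[]} B S-trivial)
      RAB-bal : Balanced Σg (R ++ A ++ B)
      RAB-bal = ≡.trans (walkSign-++ R (A ++ B))
                  (cong₂ _·_ R-unb (≡.trans (≡.sym (walkSign-drop-balanced A S B S-sign)) Q-unb))
  ... | neg = ⟦⟧-twoCycles R A S B ih cR R-unb wA
                (simpleClosedWalk-unbalanced (simpleClosedWalk S S≢[] wS (tails-suffix-unique A S AS-ts)) S-sign)
                S-sign wB B≢[] AB-bal AS-ts
    where
      AB-bal : Balanced Σg (A ++ B)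
      AB-bal = Sign.opposite-injective (≡.trans (≡.sym (walkSign-drop-unbalanced A S B S-sign)) Q-unb)

  ⟦⟧-balanced-step : ∀ {x} W → BalancedBelow (length W) → IsWalk Σg x W x → Balanced Σg W → ⟦ W ⟧ ≋ 1⋊
  ⟦⟧-balanced-step W ih w W-bal with closedWalkSplit W w
  ... | simple W-ts = ⟦⟧-distinctVertices W w W-ts W-bal
  ⟦⟧-balanced-step _ ih w W-bal | split A R B R≢[] B≢[] wA wR wB AR-ts
    with simpleClosedWalk R R≢[] wR (tails-suffix-unique A R AR-ts) | walkSign Σg R in R-sign
  ... | R-simple | pos = ⋊.trans (⟦⟧-cong-middle A {R} {[]} B (⟦⟧-simpleClosedWalk R-simple R-sign))
      (ih (A ++ B) (IsWalk-++ A wA wB) (≡.trans (≡.sym (walkSign-drop-balanced A R B R-sign)) W-bal)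
          (length-<-↭ {xs = A ++ B} {ys = R} R≢[] (↭.solve 3 (λ a r b → (a ⊕ b) ⊕ r ⊜ a ⊕ r ⊕ b) ↭-refl A R B)))
  ... | R-simple | neg =
      (⟦⟧-rotate (R ++ B) A (subst (λ W → ⟦ W ⟧ ≋ 1⋊) (≡.sym (++-assoc R B A))
        (⟦⟧-unbalancedCycle-++ R (B ++ A)
          (subst BalancedBelow (↭-length (↭.solve 3 (λ a r b → a ⊕ r ⊕ b ⊜ r ⊕ b ⊕ a) ↭-refl A R B)) ih)
          (simpleClosedWalk-unbalanced R-simple R-sign) R-sign (IsWalk-++ B wB wA)
          (≡.trans (walkSign-comm B A)
                   (Sign.opposite-injective (≡.trans (≡.sym (walkSign-drop-unbalanced A R B R-sign)) W-bal))))))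

  ⟦⟧-balanced : ∀ {x} W → IsWalk Σg x W x → Balanced Σg W → ⟦ W ⟧ ≋ 1⋊
  ⟦⟧-balanced W = <-rec Claim step (length W) W refl
    where
      Claim : ℕ → Set ℓ
      Claim n = ∀ {x} W → length W ≡ n → IsWalk Σg x W x → Balanced Σg W → ⟦ W ⟧ ≋ 1⋊
      step : ∀ n → (∀ {m} → m < n → Claim m) → Claim n
      step _ rec W refl = ⟦⟧-balanced-step W (λ W′ w′ bal′ lt → rec lt W′ refl w′ bal′)

  In2G-plainSum-closedWalk : (∀ v C → IsCycleWalk Σg v C → Unbalanced Σg C → In2G Σg ω G (plainSum Σg ω G f C)) →
                             ∀ {x} W → IsWalk Σg x W x → In2G Σg ω G (plainSum Σg ω G f W)
  In2G-plainSum-closedWalk cycles W = <-rec Claim step (length W) W refl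
    where
      Claim : ℕ → Set (c ⊔ ℓ)
      Claim n = ∀ {x} W → length W ≡ n → IsWalk Σg x W x → In2G Σg ω G (plainSum Σg ω G f W)
      step : ∀ n → (∀ {m} → m < n → Claim m) → Claim n
      step _ rec W refl w with walkSign Σg W in W-sign
      ... | pos = wsum≈ε⇒In2G-plainSum W (proj₁ (⟦⟧-balanced W w W-sign))
      ... | neg with closedWalkSplit W w
      ...   | simple W-ts =
        cycles _ W (simpleClosedWalk-unbalanced (simpleClosedWalk W (unbalanced-≢[] W-sign) w W-ts) W-sign) W-sign
      ...   | split A R B R≢[] B≢[] wA wR wB _ =
        In2G-cong (≈-sym (plainSum-++-middle A R B))
          (In2G-∙ (rec (length-<-↭ {xs = R} {ys = A ++ B} (++≢[]ʳ A B≢[])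
                         (↭.solve 3 (λ a r b → r ⊕ (a ⊕ b) ⊜ a ⊕ r ⊕ b) ↭-refl A R B))
                       R refl wR)
                  (rec (length-<-↭ {xs = A ++ B} {ys = R} R≢[]
                         (↭.solve 3 (λ a r b → (a ⊕ b) ⊕ r ⊜ a ⊕ r ⊕ b) ↭-refl A R B))
                       (A ++ B) refl (IsWalk-++ A wA wB)))

proposition7p5 : ∀ {c ℓ : Level} (Σg : SignedGraph) (ω : Orientation Σg) → Compatible Σg ω →
    (G : AbelianGroup c ℓ) → FiniteGroup G → (f : E Σg → AbelianGroup.Carrier G) →
    (IsTension Σg ω G f ⇔ (∀ v W → IsWalk Σg v W v → Balanced Σg W →
        AbelianGroup._≈_ G (wsum Σg ω G f W) (AbelianGroup.ε G)))
    × (IsPotentialDifference Σg ω G f ⇔ (IsTension Σg ω G f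
        × (∀ v W → IsWalk Σg v W v → Unbalanced Σg W → In2G Σg ω G (plainSum Σg ω G f W))))
proposition7p5 Σg ω compatible G _ f =
    mk⇔ (λ tension _ W w W-bal → proj₁ (⟦⟧-balanced tension W w W-bal))
        (λ balanced⇒ε v W cw → balanced⇒ε v W (proj₁ cw) (circuitWalk-balanced W cw))
  , mk⇔ (λ (tension , cycles) → tension , λ _ W w _ → In2G-plainSum-closedWalk tension cycles W w)
        (λ (tension , closed) → tension , λ v W cw W-unb → closed v W (proj₁ cw) W-unb)
  where
    open Walks Σg using (circuitWalk-balanced)
    open ClosedWalks Σg ω compatible G f using (⟦⟧-balanced; In2G-plainSum-closedWalk)
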